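{- Let $1\le k<n$. Every $\theta_1(J(n,k))$-eigenvector of $J(n,k)$ equals $W^Tu$ for some real vector $u=(u_1,\dots,u_n)$ with $\sum_{i=1}^n u_i=0$. Moreover, if $u\in\mathbb R^n$ satisfies $\sum_i u_i=0$ and $W^Tu$ is an integer $\theta_1(J(n,k))$-eigenvector of $J(n,k)$, then all $u_i$ ($1\le i\le n$) have the same fractional part, and this fractional part equals $\frac rs$ for some non-negative integers $r,s$ with $0\le r<s$, $\gcd(r,s)=1$ and $s$ dividing $\gcd(n,k)$.
   Context: $J(n,k)$ is the Johnson graph on the $k$-subsets of $\{1,\dots,n\}$, adjacent iff they meet in $k-1$ elements; $\theta_1(J(n,k))=(k-1)(n-k-1)-1$ is its second largest eigenvalue. $W$ is the $n\times\binom nk$ incidence matrix of points versus $k$-subsets, so $(W^Tu)_K=\sum_{i\in K}u_i$ for every $k$-subset $K$. -}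

module Defs where

open import Level using (Level; _⊔_) renaming (suc to lsuc)
open import Algebra.Bundles using (CommutativeRing)
open import Relation.Binary.Core using (Rel)
open import Relation.Binary.Structures using (IsTotalOrder)
open import Relation.Nullary using (¬_)
open import Data.Product using (Σ; ∃; _×_; _,_)
open import Data.Bool using (Bool; true; false; if_then_else_)
open import Data.Nat as ℕ using (ℕ; zero; suc; _∸_)
import Data.Nat.Properties as ℕP
open import Data.Integer as ℤ using (ℤ; +_; -[1+_])
open import Data.List using (List; []; _∷_; _++_; map; filter; foldr; allFin)
open import Data.Vec using ([]; _∷_; lookup)
open import Data.Fin using (Fin)
open import Data.Fin.Subset using (Subset; ∣_∣; _∩_)
open import Relation.Binary.PropositionalEquality using (_≡_)

record OrderedField (c ℓ₁ ℓ₂ : Level) : Set (lsuc (c ⊔ ℓ₁ ⊔ ℓ₂)) where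
  field
    commutativeRing : CommutativeRing c ℓ₁
  open CommutativeRing commutativeRing public
  field
    _≤_            : Rel Carrier ℓ₂
    ≤-isTotalOrder : IsTotalOrder _≈_ _≤_
    +-monoˡ-≤      : ∀ {x y} z → x ≤ y → (x + z) ≤ (y + z)
    *-nonneg       : ∀ {x y} → 0# ≤ x → 0# ≤ y → 0# ≤ (x * y)
    0≉1            : ¬ (0# ≈ 1#)
    inverse        : ∀ x → ¬ (x ≈ 0#) → ∃ λ y → (x * y) ≈ 1#

  _<_ : Rel Carrier (ℓ₁ ⊔ ℓ₂)
  x < y = (x ≤ y) × ¬ (x ≈ y)

  fromℕ : ℕ → Carrier
  fromℕ zero    = 0#
  fromℕ (suc m) = 1# + fromℕ m

  fromℤ : ℤ → Carrier
  fromℤ (+ m)      = fromℕ m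
  fromℤ -[1+ m ]   = - fromℕ (suc m)

-- An ordered field with an integer-part (floor) function; ℝ is one.
record FloorField (c ℓ₁ ℓ₂ : Level) : Set (lsuc (c ⊔ ℓ₁ ⊔ ℓ₂)) where
  field
    orderedField : OrderedField c ℓ₁ ℓ₂
  open OrderedField orderedField public
  field
    ⌊_⌋    : Carrier → ℤ
    ⌊⌋-≤   : ∀ x → fromℤ ⌊ x ⌋ ≤ x
    <-⌊⌋+1 : ∀ x → x < fromℤ (⌊ x ⌋ ℤ.+ ℤ.1ℤ)

  frac : Carrier → Carrier
  frac x = x - fromℤ ⌊ x ⌋

allSubsets : (n : ℕ) → List (Subset n)
allSubsets zero    = [] ∷ []
allSubsets (suc n) = map (true ∷_) (allSubsets n) ++ map (false ∷_) (allSubsets n)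

kSubsets : (n k : ℕ) → List (Subset n)
kSubsets n k = filter (λ S → ∣ S ∣ ℕ.≟ k) (allSubsets n)

θ₁ : ℕ → ℕ → ℤ
θ₁ n k = ((+ k) ℤ.- ℤ.1ℤ) ℤ.* ((+ n) ℤ.- (+ k) ℤ.- ℤ.1ℤ) ℤ.- ℤ.1ℤ

-- Linear algebra of J(n,k) over a floor field F.
-- Vectors indexed by k-subsets are functions Subset n → Carrier (only
-- their values on k-subsets matter).

module Over {c ℓ₁ ℓ₂} (F : FloorField c ℓ₁ ℓ₂) where
  open FloorField F

  ∑ : {A : Set} → List A → (A → Carrier) → Carrier
  ∑ xs f = foldr (λ x acc → f x + acc) 0# xs

  adj : (n k : ℕ) → (Subset n → Carrier) → Subset n → Carrier
  adj n k v K = ∑ (filter (λ L → ∣ K ∩ L ∣ ℕ.≟ (k ∸ 1)) (kSubsets n k)) v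

  Wᵀ : (n : ℕ) → (Fin n → Carrier) → Subset n → Carrier
  Wᵀ n u K = ∑ (allFin n) (λ i → if lookup K i then u i else 0#)

  sumAll : (n : ℕ) → (Fin n → Carrier) → Carrier
  sumAll n u = ∑ (allFin n) u

  IsEigenvector : (n k : ℕ) → Carrier → (Subset n → Carrier) → Set ℓ₁
  IsEigenvector n k θ v =
    (∃ λ K → (∣ K ∣ ≡ k) × ¬ (v K ≈ 0#)) ×
    (∀ K → ∣ K ∣ ≡ k → adj n k v K ≈ (θ * v K))

  IsIntegral : (n k : ℕ) → (Subset n → Carrier) → Set ℓ₁
  IsIntegral n k v = ∀ K → ∣ K ∣ ≡ k → ∃ λ (m : ℤ) → v K ≈ fromℤ m

{-# OPTIONS --safe #-}
module Submission where

-- For a function v on k-sets let down v be its sums over the k-sets containing a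
-- given (k-1)-set, and for w on (k-1)-sets let up w be its sums over the (k-1)-subsets
-- of a given k-set.  Counting common subsets and supersets gives, with A the adjacency
-- operator of J(n,k), up ∘ down = k + A on k-sets and
-- down ∘ up + (k-1) = up ∘ down + (n-k+1) on (k-1)-sets.  Hence down sends a
-- θ₁(J(n,k))-eigenvector v to a θ₁(J(n,k-1))-eigenvector, which by induction on k
-- is Wᵀu′ with ∑ u′ = 0; as up (Wᵀu′) = (k-1) Wᵀu′ and up (down v) = (k-1)(n-k) v,
-- v = Wᵀ(u′/(n-k)).  For k = 1, v is Wᵀ of its values on singletons.
--
-- If Wᵀu is integral, Wᵀu(R ∪ {i}) - Wᵀu(R ∪ {j}) = uᵢ - uⱼ shows that all uᵢ
-- share a fractional part f.  One k-set gives k f ∈ ℤ and ∑ u = 0 gives n f ∈ ℤ,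
-- so gcd(n,k) f ∈ ℤ by Bézout; as 0 ≤ f < 1 this integer is below gcd(n,k), and
-- reducing the fraction gives r/s.

open import Defs
import Algebra.Solver.Ring as RingSolver
import Algebra.Solver.Ring.AlmostCommutativeRing as ACR
open import Data.Bool using (Bool; true; false; if_then_else_; _∧_; _∨_)
import Data.Bool.Properties as Boolₚ
open import Data.Empty using (⊥-elim)
open import Data.Fin using (Fin)
import Data.Fin as Fin
open import Data.Fin.Subset using (Subset; ∣_∣; _∩_; _∪_; _─_; ⊥; ⊤; ⁅_⁆)
import Data.Fin.Subset.Properties as Subsetₚ
open import Data.Integer as ℤ using (ℤ; -[1+_]; _◃_; _⊖_)
import Data.Integer.Properties as ℤₚ
open import Data.Integer.Tactic.RingSolver using (solve-∀)
open import Data.List using (List; []; _∷_; _++_; map; filter; allFin; tabulate)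
open import Data.Maybe using (Maybe; just; nothing)
open import Data.Nat as ℕ using (ℕ; zero; suc; _≡ᵇ_)
import Data.Nat.Properties as ℕₚ
open import Data.Nat.Combinatorics using (_C_; nCk+nC[k+1]≡[n+1]C[k+1]; nCn≡1; nC1≡n; nCk≡nC[n∸k]; k>n⇒nCk≡0)
open import Data.Nat.Divisibility using (_∣_; divides)
open import Data.Nat.GCD
  using (gcd; gcd-GCD; GCD; module GCD; GCD-*; gcd[m,n]∣m; gcd[m,n]∣n; gcd[m,n]≢0; module Bézout)
open import Data.Product using (∃; ∃₂; _×_; _,_; proj₁; proj₂)
open import Data.Sign as Sign using (Sign)
open import Data.Sum using (inj₁; inj₂)
open import Data.Vec using ([]; _∷_; lookup)
import Data.Vec.Properties as Vecₚ
open import Function using (Equivalence)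
open import Relation.Binary.Bundles using (Poset)
open import Relation.Binary.Definitions using (tri<; tri≈; tri>)
open import Relation.Binary.Structures using (IsTotalOrder)
import Relation.Binary.PropositionalEquality as ≡
open ≡ using (_≡_; _≢_)
open import Relation.Nullary using (¬_; yes; no; does)
open import Relation.Unary using (Decidable)

private
  variable
    n : ℕ

module _ where
  open import Data.Nat using (_+_)
  open ≡ using (refl; sym; trans; cong; cong₂; subst; subst₂; module ≡-Reasoning)

  infix 7 _⊆ᵇ_ _==_

  _⊆ᵇ_ : Subset n → Subset n → Bool
  []          ⊆ᵇ []          = true
  (true  ∷ A) ⊆ᵇ (true  ∷ B) = A ⊆ᵇ B
  (true  ∷ A) ⊆ᵇ (false ∷ B) = false
  (false ∷ A) ⊆ᵇ (_     ∷ B) = A ⊆ᵇ B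

  _==_ : Subset n → Subset n → Bool
  []          == []          = true
  (true  ∷ A) == (true  ∷ B) = A == B
  (false ∷ A) == (false ∷ B) = A == B
  (true  ∷ A) == (false ∷ B) = false
  (false ∷ A) == (true  ∷ B) = false

  ==⇒≡ : (A B : Subset n) → (A == B) ≡ true → A ≡ B
  ==⇒≡ []          []          _ = refl
  ==⇒≡ (true  ∷ A) (true  ∷ B) e = cong (true ∷_) (==⇒≡ A B e)
  ==⇒≡ (false ∷ A) (false ∷ B) e = cong (false ∷_) (==⇒≡ A B e)

  ∣∣≡ᵇ0 : (S : Subset n) → (∣ S ∣ ≡ᵇ 0) ≡ (⊥ == S)
  ∣∣≡ᵇ0 []          = refl
  ∣∣≡ᵇ0 (true  ∷ S) = refl
  ∣∣≡ᵇ0 (false ∷ S) = ∣∣≡ᵇ0 S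

  ≢∣∣⇒==-false : (A B : Subset n) → ∣ A ∣ ≢ ∣ B ∣ → (A == B) ≡ false
  ≢∣∣⇒==-false A B ne with A == B in e
  ... | false = refl
  ... | true  = ⊥-elim (ne (cong ∣_∣ (==⇒≡ A B e)))

  ⊆ᵇ⇒∣∣≤ : (S K : Subset n) → S ⊆ᵇ K ≡ true → ∣ S ∣ ℕ.≤ ∣ K ∣
  ⊆ᵇ⇒∣∣≤ []          []          _ = ℕ.z≤n
  ⊆ᵇ⇒∣∣≤ (true  ∷ S) (true  ∷ K) e = ℕ.s≤s (⊆ᵇ⇒∣∣≤ S K e)
  ⊆ᵇ⇒∣∣≤ (false ∷ S) (true  ∷ K) e = ℕₚ.m≤n⇒m≤1+n (⊆ᵇ⇒∣∣≤ S K e)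
  ⊆ᵇ⇒∣∣≤ (false ∷ S) (false ∷ K) e = ⊆ᵇ⇒∣∣≤ S K e

  ⊆ᵇ-same-size : (S K : Subset n) → S ⊆ᵇ K ≡ true → ∣ S ∣ ≡ ∣ K ∣ → (K == S) ≡ true
  ⊆ᵇ-same-size []          []          _ _ = refl
  ⊆ᵇ-same-size (true  ∷ S) (true  ∷ K) e s = ⊆ᵇ-same-size S K e (ℕₚ.suc-injective s)
  ⊆ᵇ-same-size (false ∷ S) (false ∷ K) e s = ⊆ᵇ-same-size S K e s
  ⊆ᵇ-same-size (false ∷ S) (true  ∷ K) e s =
    ⊥-elim (ℕₚ.<-irrefl s (ℕ.s≤s (⊆ᵇ⇒∣∣≤ S K e)))

  ⊥⊆ᵇ : (S : Subset n) → ⊥ ⊆ᵇ S ≡ true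
  ⊥⊆ᵇ []      = refl
  ⊥⊆ᵇ (_ ∷ S) = ⊥⊆ᵇ S

  ⊆ᵇ⊤ : (S : Subset n) → S ⊆ᵇ ⊤ ≡ true
  ⊆ᵇ⊤ []          = refl
  ⊆ᵇ⊤ (true  ∷ S) = ⊆ᵇ⊤ S
  ⊆ᵇ⊤ (false ∷ S) = ⊆ᵇ⊤ S

  ⊆ᵇ-refl : (S : Subset n) → S ⊆ᵇ S ≡ true
  ⊆ᵇ-refl []          = refl
  ⊆ᵇ-refl (true  ∷ S) = ⊆ᵇ-refl S
  ⊆ᵇ-refl (false ∷ S) = ⊆ᵇ-refl S

  ⊆ᵇ-∩ : (S K L : Subset n) → (S ⊆ᵇ K ∧ S ⊆ᵇ L) ≡ S ⊆ᵇ (K ∩ L)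
  ⊆ᵇ-∩ []          []          []          = refl
  ⊆ᵇ-∩ (true  ∷ S) (true  ∷ K) (true  ∷ L) = ⊆ᵇ-∩ S K L
  ⊆ᵇ-∩ (true  ∷ S) (true  ∷ K) (false ∷ L) = Boolₚ.∧-zeroʳ _
  ⊆ᵇ-∩ (true  ∷ S) (false ∷ K) (_     ∷ L) = refl
  ⊆ᵇ-∩ (false ∷ S) (_     ∷ K) (_     ∷ L) = ⊆ᵇ-∩ S K L

  ∪-⊆ᵇ : (S T K : Subset n) → (S ⊆ᵇ K ∧ T ⊆ᵇ K) ≡ (S ∪ T) ⊆ᵇ K
  ∪-⊆ᵇ []          []          []          = refl
  ∪-⊆ᵇ (true  ∷ S) (true  ∷ T) (true  ∷ K) = ∪-⊆ᵇ S T K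
  ∪-⊆ᵇ (true  ∷ S) (false ∷ T) (true  ∷ K) = ∪-⊆ᵇ S T K
  ∪-⊆ᵇ (false ∷ S) (true  ∷ T) (true  ∷ K) = ∪-⊆ᵇ S T K
  ∪-⊆ᵇ (false ∷ S) (false ∷ T) (_     ∷ K) = ∪-⊆ᵇ S T K
  ∪-⊆ᵇ (true  ∷ S) (_     ∷ T) (false ∷ K) = refl
  ∪-⊆ᵇ (false ∷ S) (true  ∷ T) (false ∷ K) = Boolₚ.∧-zeroʳ _

  lookup≡⁅⁆⊆ᵇ : (S : Subset n) (i : Fin n) → lookup S i ≡ ⁅ i ⁆ ⊆ᵇ S
  lookup≡⁅⁆⊆ᵇ (true  ∷ S) Fin.zero    = sym (⊥⊆ᵇ S)
  lookup≡⁅⁆⊆ᵇ (false ∷ S) Fin.zero    = refl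
  lookup≡⁅⁆⊆ᵇ (true  ∷ S) (Fin.suc i) = lookup≡⁅⁆⊆ᵇ S i
  lookup≡⁅⁆⊆ᵇ (false ∷ S) (Fin.suc i) = lookup≡⁅⁆⊆ᵇ S i

  ∣─∣+∣∣ : (A B : Subset n) → A ⊆ᵇ B ≡ true → ∣ B ─ A ∣ + ∣ A ∣ ≡ ∣ B ∣
  ∣─∣+∣∣ []          []          _ = refl
  ∣─∣+∣∣ (true  ∷ A) (true  ∷ B) e = trans (ℕₚ.+-suc ∣ B ─ A ∣ ∣ A ∣) (cong suc (∣─∣+∣∣ A B e))
  ∣─∣+∣∣ (false ∷ A) (true  ∷ B) e = cong suc (∣─∣+∣∣ A B e)
  ∣─∣+∣∣ (false ∷ A) (false ∷ B) e = ∣─∣+∣∣ A B e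

  ∣∪∣+∣∩∣ : (S T : Subset n) → ∣ S ∪ T ∣ + ∣ S ∩ T ∣ ≡ ∣ S ∣ + ∣ T ∣
  ∣∪∣+∣∩∣ []          []          = refl
  ∣∪∣+∣∩∣ (true  ∷ S) (true  ∷ T) = cong suc (begin
    ∣ S ∪ T ∣ + suc ∣ S ∩ T ∣   ≡⟨ ℕₚ.+-suc ∣ S ∪ T ∣ ∣ S ∩ T ∣ ⟩
    suc (∣ S ∪ T ∣ + ∣ S ∩ T ∣) ≡⟨ cong suc (∣∪∣+∣∩∣ S T) ⟩
    suc (∣ S ∣ + ∣ T ∣)         ≡⟨ ℕₚ.+-suc ∣ S ∣ ∣ T ∣ ⟨
    ∣ S ∣ + suc ∣ T ∣           ∎)
    where open ≡-Reasoning
  ∣∪∣+∣∩∣ (true  ∷ S) (false ∷ T) = cong suc (∣∪∣+∣∩∣ S T)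
  ∣∪∣+∣∩∣ (false ∷ S) (true  ∷ T) = trans (cong suc (∣∪∣+∣∩∣ S T)) (sym (ℕₚ.+-suc ∣ S ∣ ∣ T ∣))
  ∣∪∣+∣∩∣ (false ∷ S) (false ∷ T) = ∣∪∣+∣∩∣ S T

  ∣∩∣≡∣∣⇒== : (S T : Subset n) → ∣ S ∩ T ∣ ≡ ∣ S ∣ → ∣ S ∩ T ∣ ≡ ∣ T ∣ → (S == T) ≡ true
  ∣∩∣≡∣∣⇒== []          []          _  _  = refl
  ∣∩∣≡∣∣⇒== (true  ∷ S) (true  ∷ T) e₁ e₂ = ∣∩∣≡∣∣⇒== S T (ℕₚ.suc-injective e₁) (ℕₚ.suc-injective e₂)
  ∣∩∣≡∣∣⇒== (false ∷ S) (false ∷ T) e₁ e₂ = ∣∩∣≡∣∣⇒== S T e₁ e₂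
  ∣∩∣≡∣∣⇒== (true  ∷ S) (false ∷ T) e₁ _  = ⊥-elim (ℕₚ.<-irrefl e₁ (ℕ.s≤s (Subsetₚ.∣p∩q∣≤∣p∣ S T)))
  ∣∩∣≡∣∣⇒== (false ∷ S) (true  ∷ T) _  e₂ = ⊥-elim (ℕₚ.<-irrefl e₂ (ℕ.s≤s (Subsetₚ.∣p∩q∣≤∣q∣ S T)))

  ∣∪∣+∣∩∣≡ : (S T : Subset n) {k : ℕ} → ∣ S ∣ ≡ suc k → ∣ T ∣ ≡ suc k →
    ∣ S ∪ T ∣ + ∣ S ∩ T ∣ ≡ suc (suc k) + k
  ∣∪∣+∣∩∣≡ S T {k} ∣S∣ ∣T∣ = trans (∣∪∣+∣∩∣ S T) (trans (cong₂ _+_ ∣S∣ ∣T∣) (ℕₚ.+-suc (suc k) k))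

  ==-false : {A B : Subset n} → ∣ A ∩ B ∣ ≢ ∣ A ∣ → (A == B) ≡ false
  ==-false {A = A} {B} ne with A == B in e
  ... | false = refl
  ... | true rewrite ==⇒≡ A B e = ⊥-elim (ne (cong ∣_∣ (Subsetₚ.∩-idem B)))

  module _ {m k : ℕ} where

    ≡ᵇ-true : m ≡ k → (m ≡ᵇ k) ≡ true
    ≡ᵇ-true e = Equivalence.to Boolₚ.T-≡ (ℕₚ.≡⇒≡ᵇ m k e)

    ≡ᵇ-true⇒≡ : (m ≡ᵇ k) ≡ true → m ≡ k
    ≡ᵇ-true⇒≡ e = ℕₚ.≡ᵇ⇒≡ m k (Equivalence.from Boolₚ.T-≡ e)

    ≡ᵇ-false⇒≢ : (m ≡ᵇ k) ≡ false → m ≢ k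
    ≡ᵇ-false⇒≢ e m≡k with trans (sym (≡ᵇ-true m≡k)) e
    ... | ()

    ≡ᵇ-false : m ≢ k → (m ≡ᵇ k) ≡ false
    ≡ᵇ-false ne with m ≡ᵇ k in e
    ... | false = refl
    ... | true  = ⊥-elim (ne (≡ᵇ-true⇒≡ e))

  [1+m]Cm≡1+m : ∀ m → suc m C m ≡ suc m
  [1+m]Cm≡1+m m = begin
    suc m C m             ≡⟨ nCk≡nC[n∸k] (ℕₚ.n≤1+n m) ⟩
    suc m C (suc m ℕ.∸ m) ≡⟨ cong (suc m C_) (ℕₚ.m+n∸n≡m 1 m) ⟩
    suc m C 1             ≡⟨ nC1≡n (suc m) ⟩
    suc m                 ∎
    where open ≡-Reasoning

  -- The number of j-sets S with A ⊆ S ⊆ B when ∣ A ∣ = a and ∣ B ─ A ∣ = d.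
  intervalCount : ℕ → ℕ → ℕ → ℕ
  intervalCount d zero    j       = d C j
  intervalCount d (suc a) zero    = 0
  intervalCount d (suc a) (suc j) = intervalCount d a j

  intervalCount-zero : ∀ d a → intervalCount (suc d) a 0 ≡ intervalCount d a 0
  intervalCount-zero d zero    = refl
  intervalCount-zero d (suc a) = refl

  intervalCount-pascal : ∀ d a j →
    intervalCount (suc d) a (suc j) ≡ intervalCount d a j + intervalCount d a (suc j)
  intervalCount-pascal d zero    j       = sym (nCk+nC[k+1]≡[n+1]C[k+1] d j)
  intervalCount-pascal d (suc a) zero    = intervalCount-zero d a
  intervalCount-pascal d (suc a) (suc j) = intervalCount-pascal d a j

  intervalCount-< : ∀ d {a j} → j ℕ.< a → intervalCount d a j ≡ 0
  intervalCount-< d {suc a} {zero}  _           = refl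
  intervalCount-< d {suc a} {suc j} (ℕ.s≤s j<a) = intervalCount-< d j<a

  intervalCount-1 : ∀ k → intervalCount k 1 k ≡ k
  intervalCount-1 zero    = refl
  intervalCount-1 (suc k) = [1+m]Cm≡1+m k

  intervalCount-+ : ∀ d a t → intervalCount d a (a + t) ≡ d C t
  intervalCount-+ d zero    t = refl
  intervalCount-+ d (suc a) t = intervalCount-+ d a t

  ∣∩∣≡suc : (K L : Subset n) {k : ℕ} → ∣ K ∣ ≡ suc k → k ℕ.< ∣ K ∩ L ∣ → ∣ K ∩ L ∣ ≡ suc k
  ∣∩∣≡suc K L ∣K∣ gt = ℕₚ.≤-antisym (subst (∣ K ∩ L ∣ ℕ.≤_) ∣K∣ (Subsetₚ.∣p∩q∣≤∣p∣ K L)) gt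

  ∩-binomial : {K L : Subset n} {k : ℕ} → ∣ K ∣ ≡ suc k → ∣ L ∣ ≡ suc k →
    ∣ K ∩ L ∣ C k ≡ (if K == L then suc k else 0) + (if ∣ K ∩ L ∣ ≡ᵇ k then 1 else 0)
  ∩-binomial {K = K} {L} {k} ∣K∣ ∣L∣ with ℕₚ.<-cmp ∣ K ∩ L ∣ k
  ... | tri< lt _ _
    rewrite ==-false {A = K} {L} (λ e → ℕₚ.<-asym lt (subst (k ℕ.<_) (sym (trans e ∣K∣)) (ℕₚ.n<1+n k)))
          | ≡ᵇ-false (ℕₚ.<⇒≢ lt) = k>n⇒nCk≡0 lt
  ... | tri≈ _ eq _
    rewrite ==-false {A = K} {L} (λ e → ℕₚ.<-irrefl (trans (sym eq) (trans e ∣K∣)) (ℕₚ.n<1+n k))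
          | ≡ᵇ-true eq = trans (cong (_C k) eq) (nCn≡1 k)
  ... | tri> _ _ gt
    rewrite ∣∩∣≡∣∣⇒== K L (trans (∣∩∣≡suc K L ∣K∣ gt) (sym ∣K∣)) (trans (∣∩∣≡suc K L ∣K∣ gt) (sym ∣L∣))
          | ≡ᵇ-false (λ e → ℕₚ.<-irrefl (sym e) gt)
    = trans (cong (_C k) (∣∩∣≡suc K L ∣K∣ gt)) (trans ([1+m]Cm≡1+m k) (sym (ℕₚ.+-identityʳ (suc k))))

  ∪-supersets : (S T : Subset n) {k d : ℕ} → ∣ S ∣ ≡ suc k → ∣ T ∣ ≡ suc k → d + suc k ≡ n →
    intervalCount ∣ ⊤ ─ (S ∪ T) ∣ ∣ S ∪ T ∣ (suc (suc k)) + (if S == T then suc k else 0)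
      ≡ ∣ S ∩ T ∣ C k + (if S == T then d else 0)
  ∪-supersets {n} S T {k} {d} ∣S∣ ∣T∣ d+k+1≡n with ℕₚ.<-cmp ∣ S ∩ T ∣ k
  ... | tri< lt _ _ = begin
    intervalCount _ ∣ S ∪ T ∣ (suc (suc k)) + (if S == T then suc k else 0)
      ≡⟨ cong₂ _+_ (intervalCount-< _ ∪-large) (cong (if_then suc k else 0) S≠T) ⟩
    0 + 0
      ≡⟨ cong₂ _+_ (k>n⇒nCk≡0 lt) (cong (if_then d else 0) S≠T) ⟨
    ∣ S ∩ T ∣ C k + (if S == T then d else 0) ∎
    where
    open ≡-Reasoning
    S≠T = ==-false {A = S} {T} (λ e → ℕₚ.<-asym lt (subst (k ℕ.<_) (sym (trans e ∣S∣)) (ℕₚ.n<1+n k)))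
    ∪-large : suc (suc k) ℕ.< ∣ S ∪ T ∣
    ∪-large = ℕₚ.≰⇒> λ le → ℕₚ.<-irrefl (∣∪∣+∣∩∣≡ S T ∣S∣ ∣T∣) (ℕₚ.+-mono-≤-< le lt)
  ... | tri≈ _ eq _ = begin
    intervalCount c ∣ S ∪ T ∣ (suc (suc k)) + (if S == T then suc k else 0)
      ≡⟨ cong₂ _+_ (cong (λ u → intervalCount c u (suc (suc k))) ∣S∪T∣) (cong (if_then suc k else 0) S≠T) ⟩
    intervalCount c (suc (suc k)) (suc (suc k)) + 0
      ≡⟨ cong (_+ 0) (trans (cong (intervalCount c (suc (suc k))) (sym (ℕₚ.+-identityʳ (suc (suc k)))))
                            (intervalCount-+ c (suc (suc k)) 0)) ⟩
    1 + 0
      ≡⟨ cong₂ _+_ (trans (cong (_C k) eq) (nCn≡1 k)) (cong (if_then d else 0) S≠T) ⟨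
    ∣ S ∩ T ∣ C k + (if S == T then d else 0) ∎
    where
    open ≡-Reasoning
    c = ∣ ⊤ ─ (S ∪ T) ∣
    S≠T = ==-false {A = S} {T} (λ e → ℕₚ.<-irrefl (trans (sym eq) (trans e ∣S∣)) (ℕₚ.n<1+n k))
    ∣S∪T∣ : ∣ S ∪ T ∣ ≡ suc (suc k)
    ∣S∪T∣ = ℕₚ.+-cancelʳ-≡ _ _ _ (trans (∣∪∣+∣∩∣≡ S T ∣S∣ ∣T∣) (cong (suc (suc k) +_) (sym eq)))
  ... | tri> _ _ gt = begin
    intervalCount ∣ ⊤ ─ (S ∪ T) ∣ ∣ S ∪ T ∣ (suc (suc k)) + (if S == T then suc k else 0)
      ≡⟨ cong₂ _+_ (cong₂ (λ c u → intervalCount c u (suc (suc k))) ∣⊤─S∪T∣ ∣S∪T∣)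
                   (cong (if_then suc k else 0) S=T) ⟩
    intervalCount d (suc k) (suc (suc k)) + suc k
      ≡⟨ cong (_+ suc k) (trans (cong (intervalCount d (suc k)) (ℕₚ.+-comm 1 (suc k)))
                                (trans (intervalCount-+ d (suc k) 1) (nC1≡n d))) ⟩
    d + suc k
      ≡⟨ ℕₚ.+-comm d (suc k) ⟩
    suc k + d
      ≡⟨ cong₂ _+_ (trans (cong (_C k) (∣∩∣≡suc S T ∣S∣ gt)) ([1+m]Cm≡1+m k)) (cong (if_then d else 0) S=T) ⟨
    ∣ S ∩ T ∣ C k + (if S == T then d else 0) ∎
    where
    open ≡-Reasoning
    S=T = ∣∩∣≡∣∣⇒== S T (trans (∣∩∣≡suc S T ∣S∣ gt) (sym ∣S∣)) (trans (∣∩∣≡suc S T ∣S∣ gt) (sym ∣T∣))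
    ∣S∪T∣ : ∣ S ∪ T ∣ ≡ suc k
    ∣S∪T∣ = ℕₚ.+-cancelʳ-≡ _ _ _ (trans (cong (∣ S ∪ T ∣ +_) (sym (∣∩∣≡suc S T ∣S∣ gt)))
              (trans (∣∪∣+∣∩∣≡ S T ∣S∣ ∣T∣) (sym (ℕₚ.+-suc (suc k) k))))
    ∣⊤─S∪T∣ : ∣ ⊤ ─ (S ∪ T) ∣ ≡ d
    ∣⊤─S∪T∣ = ℕₚ.+-cancelʳ-≡ _ _ _ (trans (trans (cong (∣ ⊤ ─ (S ∪ T) ∣ +_) (sym ∣S∪T∣))
                (trans (∣─∣+∣∣ (S ∪ T) ⊤ (⊆ᵇ⊤ (S ∪ T))) (Subsetₚ.∣⊤∣≡n n))) (sym d+k+1≡n))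

  disjoint-subset : ∀ n (B : Subset n) t → t + ∣ B ∣ ℕ.≤ n →
    ∃ λ R → ∣ R ∣ ≡ t × (∀ p → lookup B p ≡ true → lookup R p ≡ false)
  disjoint-subset zero    []          zero    _ = [] , refl , λ ()
  disjoint-subset (suc n) (true ∷ B)  t       t+∣B∣≤n
    with R , ∣R∣ , R∩B=∅ ← disjoint-subset n B t (ℕₚ.≤-pred (subst (ℕ._≤ suc n) (ℕₚ.+-suc t ∣ B ∣) t+∣B∣≤n))
    = false ∷ R , ∣R∣ , λ { Fin.zero _ → refl ; (Fin.suc p) e → R∩B=∅ p e }
  disjoint-subset (suc n) (false ∷ B) zero    _
    with R , ∣R∣ , R∩B=∅ ← disjoint-subset n B zero (Subsetₚ.∣p∣≤n B)
    = false ∷ R , ∣R∣ , λ { Fin.zero () ; (Fin.suc p) e → R∩B=∅ p e }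
  disjoint-subset (suc n) (false ∷ B) (suc t) t+∣B∣≤n
    with R , ∣R∣ , R∩B=∅ ← disjoint-subset n B t (ℕₚ.≤-pred t+∣B∣≤n)
    = true ∷ R , cong suc ∣R∣ , λ { Fin.zero () ; (Fin.suc p) e → R∩B=∅ p e }

  ∣∪⁅⁆∣ : (R : Subset n) (i : Fin n) → lookup R i ≡ false → ∣ R ∪ ⁅ i ⁆ ∣ ≡ suc ∣ R ∣
  ∣∪⁅⁆∣ (false ∷ R) Fin.zero    _ = cong (λ S → suc ∣ S ∣) (Subsetₚ.∪-identityʳ R)
  ∣∪⁅⁆∣ (true  ∷ R) (Fin.suc i) e = cong suc (∣∪⁅⁆∣ R i e)
  ∣∪⁅⁆∣ (false ∷ R) (Fin.suc i) e = ∣∪⁅⁆∣ R i e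

  lookup⁅⁆ : (i : Fin n) → lookup ⁅ i ⁆ i ≡ true
  lookup⁅⁆ i = Vecₚ.[]=⇒lookup (Subsetₚ.x∈⁅x⁆ i)

  ∣⁅⁆∪⁅⁆∣≤2 : (i j : Fin n) → ∣ ⁅ i ⁆ ∪ ⁅ j ⁆ ∣ ℕ.≤ 2
  ∣⁅⁆∪⁅⁆∣≤2 i j = subst (∣ ⁅ i ⁆ ∪ ⁅ j ⁆ ∣ ℕ.≤_)
    (trans (∣∪∣+∣∩∣ ⁅ i ⁆ ⁅ j ⁆) (cong₂ _+_ (Subsetₚ.∣⁅x⁆∣≡1 i) (Subsetₚ.∣⁅x⁆∣≡1 j))) (ℕₚ.m≤m+n _ _)

  lowest-terms : ∀ t g → t ℕ.< g →
    ∃₂ λ r s → ∃ λ d → (r ℕ.< s) × (gcd r s ≡ 1) × (t ≡ r ℕ.* suc d) × (g ≡ s ℕ.* suc d)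
  lowest-terms t g t<g with gcd t g | gcd-GCD t g | gcd[m,n]∣m t g | gcd[m,n]∣n t g
                          | gcd[m,n]≢0 t g (inj₂ (λ g≡0 → ℕₚ.n≮0 (subst (t ℕ.<_) g≡0 t<g)))
  ... | zero  | _ | _ | _ | gcd≢0 = ⊥-elim (gcd≢0 refl)
  ... | suc d | gcd≡d | divides r t≡r[d+1] | divides s g≡s[d+1] | _ =
    r , s , d , ℕₚ.*-cancelʳ-< (suc d) r s (subst₂ ℕ._<_ t≡r[d+1] g≡s[d+1] t<g) ,
    GCD.unique (gcd-GCD r s) (GCD-* (subst (GCD (r ℕ.* suc d) (s ℕ.* suc d)) (sym (ℕₚ.*-identityˡ (suc d)))
                                           (subst₂ (λ a b → GCD a b (suc d)) t≡r[d+1] g≡s[d+1] gcd≡d))) ,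
    t≡r[d+1] , g≡s[d+1]

module _ {ℓ ℓ₁ ℓ₂} (F : FloorField ℓ ℓ₁ ℓ₂) where
  open FloorField F
  open import Algebra.Properties.Ring ring using (-0#≈0#; -‿involutive; -‿+-comm; -1*x≈-x; +-cancelʳ)
  open import Algebra.Properties.CommutativeSemigroup *-commutativeSemigroup using (interchange)
  open import Relation.Binary.Reasoning.Setoid setoid

  ≡⇒≈ : ∀ {x y} → x ≡ y → x ≈ y
  ≡⇒≈ ≡.refl = refl

  fromℕ-+ : ∀ m k → fromℕ (m ℕ.+ k) ≈ fromℕ m + fromℕ k
  fromℕ-+ zero    k = sym (+-identityˡ _)
  fromℕ-+ (suc m) k = trans (+-congˡ (fromℕ-+ m k)) (sym (+-assoc _ _ _))

  fromℕ-* : ∀ m k → fromℕ (m ℕ.* k) ≈ fromℕ m * fromℕ k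
  fromℕ-* zero    k = sym (zeroˡ _)
  fromℕ-* (suc m) k = begin
    fromℕ (k ℕ.+ m ℕ.* k)              ≈⟨ fromℕ-+ k (m ℕ.* k) ⟩
    fromℕ k + fromℕ (m ℕ.* k)          ≈⟨ +-cong (sym (*-identityˡ _)) (fromℕ-* m k) ⟩
    1# * fromℕ k + fromℕ m * fromℕ k   ≈⟨ distribʳ _ _ _ ⟨
    (1# + fromℕ m) * fromℕ k           ∎

  fromℤ-⊖ : ∀ m k → fromℤ (m ⊖ k) ≈ fromℕ m - fromℕ k
  fromℤ-⊖ m       zero    = sym (trans (+-congˡ -0#≈0#) (+-identityʳ _))
  fromℤ-⊖ zero    (suc k) = sym (+-identityˡ _)
  fromℤ-⊖ (suc m) (suc k) = begin
    fromℤ (suc m ⊖ suc k)                        ≡⟨ ≡.cong fromℤ (ℤₚ.[1+m]⊖[1+n]≡m⊖n m k) ⟩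
    fromℤ (m ⊖ k)                                ≈⟨ fromℤ-⊖ m k ⟩
    fromℕ m - fromℕ k                            ≈⟨ +-congʳ (+-identityˡ _) ⟨
    (0# + fromℕ m) - fromℕ k                     ≈⟨ +-congʳ (+-congʳ (-‿inverseʳ 1#)) ⟨
    ((1# - 1#) + fromℕ m) - fromℕ k              ≈⟨ +-congʳ (+-assoc _ _ _) ⟩
    (1# + (- 1# + fromℕ m)) - fromℕ k            ≈⟨ +-congʳ (+-congˡ (+-comm _ _)) ⟩
    (1# + (fromℕ m - 1#)) - fromℕ k              ≈⟨ +-congʳ (+-assoc _ _ _) ⟨
    ((1# + fromℕ m) - 1#) - fromℕ k              ≈⟨ +-assoc _ _ _ ⟩
    (1# + fromℕ m) + (- 1# - fromℕ k)            ≈⟨ +-congˡ (-‿+-comm 1# (fromℕ k)) ⟩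
    (1# + fromℕ m) - (1# + fromℕ k)              ∎

  fromSign : Sign → Carrier
  fromSign Sign.+ = 1#
  fromSign Sign.- = - 1#

  fromSign-* : ∀ s t → fromSign (s Sign.* t) ≈ fromSign s * fromSign t
  fromSign-* Sign.+ Sign.+ = sym (*-identityˡ _)
  fromSign-* Sign.+ Sign.- = sym (*-identityˡ _)
  fromSign-* Sign.- Sign.+ = sym (*-identityʳ _)
  fromSign-* Sign.- Sign.- = sym (trans (-1*x≈-x _) (-‿involutive _))

  fromℤ-◃ : ∀ s m → fromℤ (s ◃ m) ≈ fromSign s * fromℕ m
  fromℤ-◃ Sign.+ zero    = sym (zeroʳ _)
  fromℤ-◃ Sign.- zero    = sym (zeroʳ _)
  fromℤ-◃ Sign.+ (suc m) = sym (*-identityˡ _)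
  fromℤ-◃ Sign.- (suc m) = sym (-1*x≈-x _)

  fromℤ≈sign*∣∣ : ∀ i → fromℤ i ≈ fromSign (ℤ.sign i) * fromℕ ℤ.∣ i ∣
  fromℤ≈sign*∣∣ i = trans (≡⇒≈ (≡.cong fromℤ (≡.sym (ℤₚ.◃-inverse i)))) (fromℤ-◃ (ℤ.sign i) ℤ.∣ i ∣)

  fromℤ-* : ∀ i j → fromℤ (i ℤ.* j) ≈ fromℤ i * fromℤ j
  fromℤ-* i j = begin
    fromℤ (i ℤ.* j)
      ≈⟨ fromℤ-◃ (ℤ.sign i Sign.* ℤ.sign j) (ℤ.∣ i ∣ ℕ.* ℤ.∣ j ∣) ⟩
    fromSign (ℤ.sign i Sign.* ℤ.sign j) * fromℕ (ℤ.∣ i ∣ ℕ.* ℤ.∣ j ∣)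
      ≈⟨ *-cong (fromSign-* (ℤ.sign i) (ℤ.sign j)) (fromℕ-* ℤ.∣ i ∣ ℤ.∣ j ∣) ⟩
    (fromSign (ℤ.sign i) * fromSign (ℤ.sign j)) * (fromℕ ℤ.∣ i ∣ * fromℕ ℤ.∣ j ∣)
      ≈⟨ interchange _ _ _ _ ⟩
    (fromSign (ℤ.sign i) * fromℕ ℤ.∣ i ∣) * (fromSign (ℤ.sign j) * fromℕ ℤ.∣ j ∣)
      ≈⟨ *-cong (fromℤ≈sign*∣∣ i) (fromℤ≈sign*∣∣ j) ⟨
    fromℤ i * fromℤ j ∎

  fromℤ-+ : ∀ i j → fromℤ (i ℤ.+ j) ≈ fromℤ i + fromℤ j
  fromℤ-+ (ℤ.+ m)  (ℤ.+ k)  = fromℕ-+ m k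
  fromℤ-+ (ℤ.+ m)  -[1+ k ] = fromℤ-⊖ m (suc k)
  fromℤ-+ -[1+ m ] (ℤ.+ k)  = trans (fromℤ-⊖ k (suc m)) (+-comm _ _)
  fromℤ-+ -[1+ m ] -[1+ k ] = begin
    - (1# + fromℕ (suc (m ℕ.+ k)))      ≡⟨ ≡.cong (λ x → - fromℕ x) (≡.sym (ℕₚ.+-suc (suc m) k)) ⟩
    - fromℕ (suc m ℕ.+ suc k)           ≈⟨ -‿cong (fromℕ-+ (suc m) (suc k)) ⟩
    - (fromℕ (suc m) + fromℕ (suc k))   ≈⟨ -‿+-comm _ _ ⟨
    - fromℕ (suc m) - fromℕ (suc k)     ∎

  fromℤ-neg : ∀ i → fromℤ (ℤ.- i) ≈ - fromℤ i
  fromℤ-neg (ℤ.+ zero)  = sym -0#≈0#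
  fromℤ-neg (ℤ.+ suc m) = refl
  fromℤ-neg -[1+ m ]    = sym (-‿involutive _)

  -- fromℤ, except that 0, 1 and -1 go to 0#, 1# and - 1# on the nose, so that
  -- the constants of solver equations match goals written with 0# and 1#.
  coefficient : ℤ → Carrier
  coefficient (ℤ.+ 0)  = 0#
  coefficient (ℤ.+ 1)  = 1#
  coefficient -[1+ 0 ] = - 1#
  coefficient i        = fromℤ i

  coefficient≈fromℤ : ∀ i → coefficient i ≈ fromℤ i
  coefficient≈fromℤ (ℤ.+ 0)           = refl
  coefficient≈fromℤ (ℤ.+ 1)           = sym (+-identityʳ _)
  coefficient≈fromℤ (ℤ.+ suc (suc m)) = refl
  coefficient≈fromℤ -[1+ 0 ]          = -‿cong (sym (+-identityʳ _))
  coefficient≈fromℤ -[1+ suc m ]      = refl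

  ℤ-coefficients : ℤ.+-*-rawRing ACR.-Raw-AlmostCommutative⟶ ACR.fromCommutativeRing commutativeRing
  ℤ-coefficients = record
    { ⟦_⟧    = coefficient
    ; +-homo = λ i j → homo (i ℤ.+ j) (fromℤ-+ i j) (+-cong (coefficient≈fromℤ i) (coefficient≈fromℤ j))
    ; *-homo = λ i j → homo (i ℤ.* j) (fromℤ-* i j) (*-cong (coefficient≈fromℤ i) (coefficient≈fromℤ j))
    ; -‿homo = λ i → homo (ℤ.- i) (fromℤ-neg i) (-‿cong (coefficient≈fromℤ i))
    ; 0-homo = refl
    ; 1-homo = refl
    }
    where
    homo : ∀ i {x y} → fromℤ i ≈ x → y ≈ x → coefficient i ≈ y
    homo i e₁ e₂ = trans (coefficient≈fromℤ i) (trans e₁ (sym e₂))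

  coefficient-≟ : ∀ i j → Maybe (coefficient i ≈ coefficient j)
  coefficient-≟ i j with i ℤ.≟ j
  ... | yes ≡.refl = just refl
  ... | no _       = nothing

  open RingSolver ℤ.+-*-rawRing (ACR.fromCommutativeRing commutativeRing) ℤ-coefficients coefficient-≟
    using (solve; _:=_; _:+_; _:*_; _:-_; con)

  open Over F

  when : Bool → Carrier → Carrier
  when b x = if b then x else 0#

  module _ {A : Set} where

    ∑-cong : (xs : List A) {f g : A → Carrier} → (∀ x → f x ≈ g x) → ∑ xs f ≈ ∑ xs g
    ∑-cong []       _   = refl
    ∑-cong (x ∷ xs) f≈g = +-cong (f≈g x) (∑-cong xs f≈g)

    ∑-zero : (xs : List A) {f : A → Carrier} → (∀ x → f x ≈ 0#) → ∑ xs f ≈ 0#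
    ∑-zero []       _   = refl
    ∑-zero (x ∷ xs) f≈0 = trans (+-cong (f≈0 x) (∑-zero xs f≈0)) (+-identityʳ 0#)

    ∑-++ : (xs ys : List A) (f : A → Carrier) → ∑ (xs ++ ys) f ≈ ∑ xs f + ∑ ys f
    ∑-++ []       ys f = sym (+-identityˡ _)
    ∑-++ (x ∷ xs) ys f = trans (+-congˡ (∑-++ xs ys f)) (sym (+-assoc _ _ _))

    ∑-map : {B : Set} (g : A → B) (xs : List A) (f : B → Carrier) → ∑ (map g xs) f ≡ ∑ xs (λ x → f (g x))
    ∑-map g []       f = ≡.refl
    ∑-map g (x ∷ xs) f = ≡.cong (f (g x) +_) (∑-map g xs f)

    ∑-+ : (xs : List A) (f g : A → Carrier) → ∑ xs (λ x → f x + g x) ≈ ∑ xs f + ∑ xs g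
    ∑-+ []       f g = sym (+-identityˡ _)
    ∑-+ (x ∷ xs) f g = begin
      (f x + g x) + ∑ xs (λ x → f x + g x) ≈⟨ +-congˡ (∑-+ xs f g) ⟩
      (f x + g x) + (∑ xs f + ∑ xs g)     ≈⟨ interchange′ (f x) (g x) (∑ xs f) (∑ xs g) ⟩
      (f x + ∑ xs f) + (g x + ∑ xs g)     ∎
      where
      interchange′ : ∀ a b c d → (a + b) + (c + d) ≈ (a + c) + (b + d)
      interchange′ = solve 4 (λ a b c d → (a :+ b) :+ (c :+ d) := (a :+ c) :+ (b :+ d)) refl

    ∑-*ˡ : (xs : List A) (a : Carrier) (f : A → Carrier) → ∑ xs (λ x → a * f x) ≈ a * ∑ xs f
    ∑-*ˡ []       a f = sym (zeroʳ _)
    ∑-*ˡ (x ∷ xs) a f = trans (+-congˡ (∑-*ˡ xs a f)) (sym (distribˡ _ _ _))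

    ∑-filter : {P : A → Set} (P? : Decidable P) (xs : List A) (f : A → Carrier) →
               ∑ (filter P? xs) f ≈ ∑ xs (λ x → when (does (P? x)) (f x))
    ∑-filter P? []       f = refl
    ∑-filter P? (x ∷ xs) f with does (P? x)
    ... | true  = +-congˡ (∑-filter P? xs f)
    ... | false = trans (∑-filter P? xs f) (sym (+-identityˡ _))


  ∑-swap : {A B : Set} (xs : List A) (ys : List B) (h : A → B → Carrier) →
           ∑ xs (λ x → ∑ ys (h x)) ≈ ∑ ys (λ y → ∑ xs (λ x → h x y))
  ∑-swap []       ys h = sym (∑-zero ys (λ _ → refl))
  ∑-swap (x ∷ xs) ys h = trans (+-congˡ (∑-swap xs ys h)) (sym (∑-+ ys (h x) _))

  ∑-allFin-suc : ∀ n (h : Fin (suc n) → Carrier) →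
                 ∑ (allFin (suc n)) h ≡ h Fin.zero + ∑ (allFin n) (λ i → h (Fin.suc i))
  ∑-allFin-suc n h = ≡.cong (h Fin.zero +_) (∑-tabulate n Fin.suc h)
    where
    ∑-tabulate : ∀ n {m} (f : Fin n → Fin m) h → ∑ (tabulate f) h ≡ ∑ (allFin n) (λ i → h (f i))
    ∑-tabulate zero    f h = ≡.refl
    ∑-tabulate (suc n) f h = ≡.cong (h (f Fin.zero) +_)
      (≡.trans (∑-tabulate n (λ i → f (Fin.suc i)) h) (≡.sym (∑-tabulate n Fin.suc (λ i → h (f i)))))

  when-cong : ∀ b {x y} → x ≈ y → when b x ≈ when b y
  when-cong true  x≈y = x≈y
  when-cong false _   = refl

  when-zero : ∀ b → when b 0# ≈ 0#
  when-zero true  = refl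
  when-zero false = refl

  when-+ : ∀ b x y → when b (x + y) ≈ when b x + when b y
  when-+ true  x y = refl
  when-+ false x y = sym (+-identityˡ _)

  when-*ˡ : ∀ b a x → a * when b x ≈ when b (a * x)
  when-*ˡ true  a x = refl
  when-*ˡ false a x = zeroʳ _

  when-zero² : ∀ a b → when a (when b 0#) ≈ 0#
  when-zero² a b = trans (when-cong a (when-zero b)) (when-zero a)

  when-∑ : {A : Set} (b : Bool) (xs : List A) (f : A → Carrier) → when b (∑ xs f) ≈ ∑ xs (λ x → when b (f x))
  when-∑ true  xs f = refl
  when-∑ false xs f = sym (∑-zero xs (λ _ → refl))

  when-∧ : ∀ a b x → when (a ∧ b) x ≡ when a (when b x)
  when-∧ true  b x = ≡.refl
  when-∧ false b x = ≡.refl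

  when-comm : ∀ a b x → when a (when b x) ≡ when b (when a x)
  when-comm true  b     x = ≡.refl
  when-comm false true  x = ≡.refl
  when-comm false false x = ≡.refl

  ∑-when-swap : {A B : Set} (xs : List A) (ys : List B) (p q : A → Bool) (s : B → Bool)
    (r : A → B → Bool) (w : B → Carrier) →
    ∑ xs (λ X → when (p X) (when (q X) (∑ ys (λ T → when (s T) (when (r X T) (w T))))))
      ≈ ∑ ys (λ T → when (s T) (w T * ∑ xs (λ X → when (p X) (when (q X) (when (r X T) 1#)))))
  ∑-when-swap xs ys p q s r w = begin
    ∑ xs (λ X → when (p X) (when (q X) (∑ ys (λ T → when (s T) (when (r X T) (w T))))))
      ≈⟨ ∑-cong xs (λ X → trans (when-cong (p X) (when-∑ (q X) ys _)) (when-∑ (p X) ys _)) ⟩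
    ∑ xs (λ X → ∑ ys (λ T → when (p X) (when (q X) (when (s T) (when (r X T) (w T))))))
      ≈⟨ ∑-swap xs ys _ ⟩
    ∑ ys (λ T → ∑ xs (λ X → when (p X) (when (q X) (when (s T) (when (r X T) (w T))))))
      ≈⟨ ∑-cong ys (λ T → ∑-cong xs (λ X → pull-out (p X) (q X) (s T) (r X T) (w T))) ⟩
    ∑ ys (λ T → ∑ xs (λ X → when (s T) (w T * when (p X) (when (q X) (when (r X T) 1#)))))
      ≈⟨ ∑-cong ys (λ T → trans (sym (when-∑ (s T) xs _)) (when-cong (s T) (∑-*ˡ xs (w T) _))) ⟩
    ∑ ys (λ T → when (s T) (w T * ∑ xs (λ X → when (p X) (when (q X) (when (r X T) 1#))))) ∎
    where
    pull-out : ∀ a b c d x → when a (when b (when c (when d x))) ≈ when c (x * when a (when b (when d 1#)))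
    pull-out a b c d x = begin
      when a (when b (when c (when d x))) ≡⟨ ≡.cong (when a) (when-comm b c _) ⟩
      when a (when c (when b (when d x))) ≡⟨ when-comm a c _ ⟩
      when c (when a (when b (when d x))) ≈⟨ when-cong c (when-cong a (when-cong b (when-cong d (*-identityʳ x)))) ⟨
      when c (when a (when b (when d (x * 1#))))
        ≈⟨ when-cong c (trans (when-*ˡ a x _) (when-cong a (trans (when-*ˡ b x _) (when-cong b (when-*ˡ d x 1#))))) ⟨
      when c (x * when a (when b (when d 1#))) ∎

  Σˢ : (n : ℕ) → (Subset n → Carrier) → Carrier
  Σˢ n f = ∑ (allSubsets n) f

  Σˢ-cong : ∀ n {f g : Subset n → Carrier} → (∀ S → f S ≈ g S) → Σˢ n f ≈ Σˢ n g
  Σˢ-cong n = ∑-cong (allSubsets n)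

  Σˢ-zero : ∀ n {f : Subset n → Carrier} → (∀ S → f S ≈ 0#) → Σˢ n f ≈ 0#
  Σˢ-zero n = ∑-zero (allSubsets n)

  Σˢ-suc : ∀ n (f : Subset (suc n) → Carrier) →
           Σˢ (suc n) f ≈ Σˢ n (λ S → f (true ∷ S)) + Σˢ n (λ S → f (false ∷ S))
  Σˢ-suc n f = begin
    ∑ (map (true ∷_) (allSubsets n) ++ map (false ∷_) (allSubsets n)) f
      ≈⟨ ∑-++ (map (true ∷_) (allSubsets n)) _ f ⟩
    ∑ (map (true ∷_) (allSubsets n)) f + ∑ (map (false ∷_) (allSubsets n)) f
      ≡⟨ ≡.cong₂ _+_ (∑-map (true ∷_) (allSubsets n) f) (∑-map (false ∷_) (allSubsets n) f) ⟩
    Σˢ n (λ S → f (true ∷ S)) + Σˢ n (λ S → f (false ∷ S)) ∎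

  Σˢ-== : ∀ {n} (K : Subset n) (f : Subset n → Carrier) → Σˢ n (λ L → when (K == L) (f L)) ≈ f K
  Σˢ-== []                  f = +-identityʳ _
  Σˢ-== {suc n} (true ∷ K)  f = begin
    Σˢ (suc n) (λ L → when ((true ∷ K) == L) (f L))            ≈⟨ Σˢ-suc n _ ⟩
    Σˢ n (λ L → when (K == L) (f (true ∷ L))) + Σˢ n (λ _ → 0#) ≈⟨ +-cong (Σˢ-== K _) (Σˢ-zero n (λ _ → refl)) ⟩
    f (true ∷ K) + 0#                                           ≈⟨ +-identityʳ _ ⟩
    f (true ∷ K)                                                ∎
  Σˢ-== {suc n} (false ∷ K) f = begin
    Σˢ (suc n) (λ L → when ((false ∷ K) == L) (f L))             ≈⟨ Σˢ-suc n _ ⟩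
    Σˢ n (λ _ → 0#) + Σˢ n (λ L → when (K == L) (f (false ∷ L))) ≈⟨ +-cong (Σˢ-zero n (λ _ → refl)) (Σˢ-== K _) ⟩
    0# + f (false ∷ K)                                           ≈⟨ +-identityˡ _ ⟩
    f (false ∷ K)                                                ∎

  #between : ∀ {n} → Subset n → Subset n → ℕ → Carrier
  #between {n} A B j = Σˢ n (λ S → when (∣ S ∣ ≡ᵇ j) (when (A ⊆ᵇ S) (when (S ⊆ᵇ B) 1#)))

  #between≈ : ∀ {n} (A B : Subset n) j →
              #between A B j ≈ when (A ⊆ᵇ B) (fromℕ (intervalCount ∣ B ─ A ∣ ∣ A ∣ j))
  #between≈ []          []          zero    = refl
  #between≈ []          []          (suc j) = +-identityʳ 0#
  #between≈ {suc n} (true ∷ A) (true ∷ B) zero = begin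
    #between (true ∷ A) (true ∷ B) 0          ≈⟨ Σˢ-suc n _ ⟩
    Σˢ n (λ _ → 0#) + Σˢ n (λ S → when (∣ S ∣ ≡ᵇ 0) 0#)
      ≈⟨ +-cong (Σˢ-zero n (λ _ → refl)) (Σˢ-zero n (λ S → when-zero (∣ S ∣ ≡ᵇ 0))) ⟩
    0# + 0#                                    ≈⟨ +-identityʳ 0# ⟩
    0#                                         ≈⟨ when-zero (A ⊆ᵇ B) ⟨
    when (A ⊆ᵇ B) (fromℕ 0)                   ∎
  #between≈ {suc n} (true ∷ A) (true ∷ B) (suc j) = begin
    #between (true ∷ A) (true ∷ B) (suc j)    ≈⟨ Σˢ-suc n _ ⟩
    #between A B j + Σˢ n (λ S → when (∣ S ∣ ≡ᵇ suc j) 0#)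
      ≈⟨ +-cong (#between≈ A B j) (Σˢ-zero n (λ S → when-zero (∣ S ∣ ≡ᵇ suc j))) ⟩
    when (A ⊆ᵇ B) (fromℕ (intervalCount ∣ B ─ A ∣ ∣ A ∣ j)) + 0# ≈⟨ +-identityʳ _ ⟩
    when (A ⊆ᵇ B) (fromℕ (intervalCount ∣ B ─ A ∣ ∣ A ∣ j)) ∎
  #between≈ {suc n} (true ∷ A) (false ∷ B) j = begin
    #between (true ∷ A) (false ∷ B) j          ≈⟨ Σˢ-suc n _ ⟩
    Σˢ n (λ S → when (suc ∣ S ∣ ≡ᵇ j) (when (A ⊆ᵇ S) 0#)) + Σˢ n (λ S → when (∣ S ∣ ≡ᵇ j) 0#)
      ≈⟨ +-cong (Σˢ-zero n (λ S → when-zero² (suc ∣ S ∣ ≡ᵇ j) (A ⊆ᵇ S)))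
                (Σˢ-zero n (λ S → when-zero (∣ S ∣ ≡ᵇ j))) ⟩
    0# + 0#                                     ≈⟨ +-identityʳ 0# ⟩
    0#                                          ∎
  #between≈ {suc n} (false ∷ A) (true ∷ B) zero = begin
    #between (false ∷ A) (true ∷ B) 0          ≈⟨ Σˢ-suc n _ ⟩
    Σˢ n (λ _ → 0#) + #between A B 0          ≈⟨ +-cong (Σˢ-zero n (λ _ → refl)) (#between≈ A B 0) ⟩
    0# + when (A ⊆ᵇ B) (fromℕ (intervalCount ∣ B ─ A ∣ ∣ A ∣ 0))   ≈⟨ +-identityˡ _ ⟩
    when (A ⊆ᵇ B) (fromℕ (intervalCount ∣ B ─ A ∣ ∣ A ∣ 0))
      ≡⟨ ≡.cong (λ m → when (A ⊆ᵇ B) (fromℕ m)) (intervalCount-zero ∣ B ─ A ∣ ∣ A ∣) ⟨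
    when (A ⊆ᵇ B) (fromℕ (intervalCount (suc ∣ B ─ A ∣) ∣ A ∣ 0)) ∎
  #between≈ {suc n} (false ∷ A) (true ∷ B) (suc j) = begin
    #between (false ∷ A) (true ∷ B) (suc j)    ≈⟨ Σˢ-suc n _ ⟩
    #between A B j + #between A B (suc j)      ≈⟨ +-cong (#between≈ A B j) (#between≈ A B (suc j)) ⟩
    when b (fromℕ (intervalCount d a j)) + when b (fromℕ (intervalCount d a (suc j)))
      ≈⟨ when-+ b _ _ ⟨
    when b (fromℕ (intervalCount d a j) + fromℕ (intervalCount d a (suc j)))
      ≈⟨ when-cong b (fromℕ-+ (intervalCount d a j) (intervalCount d a (suc j))) ⟨
    when b (fromℕ (intervalCount d a j ℕ.+ intervalCount d a (suc j)))
      ≡⟨ ≡.cong (λ m → when b (fromℕ m)) (intervalCount-pascal d a j) ⟨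
    when b (fromℕ (intervalCount (suc d) a (suc j))) ∎
    where
    b = A ⊆ᵇ B
    d = ∣ B ─ A ∣
    a = ∣ A ∣
  #between≈ {suc n} (false ∷ A) (false ∷ B) j = begin
    #between (false ∷ A) (false ∷ B) j         ≈⟨ Σˢ-suc n _ ⟩
    Σˢ n (λ S → when (suc ∣ S ∣ ≡ᵇ j) (when (A ⊆ᵇ S) 0#)) + #between A B j
      ≈⟨ +-cong (Σˢ-zero n (λ S → when-zero² (suc ∣ S ∣ ≡ᵇ j) (A ⊆ᵇ S))) (#between≈ A B j) ⟩
    0# + when (A ⊆ᵇ B) (fromℕ (intervalCount ∣ B ─ A ∣ ∣ A ∣ j)) ≈⟨ +-identityˡ _ ⟩
    when (A ⊆ᵇ B) (fromℕ (intervalCount ∣ B ─ A ∣ ∣ A ∣ j)) ∎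

  up : ∀ n → ℕ → (Subset n → Carrier) → Subset n → Carrier
  up n j w K = Σˢ n (λ S → when (∣ S ∣ ≡ᵇ j) (when (S ⊆ᵇ K) (w S)))

  down : ∀ n → ℕ → (Subset n → Carrier) → Subset n → Carrier
  down n j v S = Σˢ n (λ K → when (∣ K ∣ ≡ᵇ j) (when (S ⊆ᵇ K) (v K)))

  up-down : ∀ n a b w S →
    up n a (down n b w) S ≈ Σˢ n (λ T → when (∣ T ∣ ≡ᵇ b) (w T * fromℕ (∣ S ∩ T ∣ C a)))
  up-down n a b w S = begin
    up n a (down n b w) S
      ≈⟨ ∑-when-swap (allSubsets n) (allSubsets n) (λ R → ∣ R ∣ ≡ᵇ a) (_⊆ᵇ S) (λ T → ∣ T ∣ ≡ᵇ b) _⊆ᵇ_ w ⟩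
    Σˢ n (λ T → when (∣ T ∣ ≡ᵇ b) (w T * Σˢ n (λ R → when (∣ R ∣ ≡ᵇ a) (when (R ⊆ᵇ S) (when (R ⊆ᵇ T) 1#)))))
      ≈⟨ Σˢ-cong n (λ T → when-cong (∣ T ∣ ≡ᵇ b)
           (*-congˡ (Σˢ-cong n (λ R → ≡⇒≈ (≡.cong (when (∣ R ∣ ≡ᵇ a)) (⊆-∩ R T)))))) ⟩
    Σˢ n (λ T → when (∣ T ∣ ≡ᵇ b) (w T * #between ⊥ (S ∩ T) a))
      ≈⟨ Σˢ-cong n (λ T → when-cong (∣ T ∣ ≡ᵇ b) (*-congˡ (#between-⊥ (S ∩ T)))) ⟩
    Σˢ n (λ T → when (∣ T ∣ ≡ᵇ b) (w T * fromℕ (∣ S ∩ T ∣ C a))) ∎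
    where
    ⊆-∩ : ∀ R T → when (R ⊆ᵇ S) (when (R ⊆ᵇ T) 1#) ≡ when (⊥ ⊆ᵇ R) (when (R ⊆ᵇ (S ∩ T)) 1#)
    ⊆-∩ R T = ≡.trans (≡.sym (when-∧ (R ⊆ᵇ S) (R ⊆ᵇ T) 1#))
              (≡.trans (≡.cong (λ b → when b 1#) (⊆ᵇ-∩ R S T))
                       (≡.cong (λ b → when b (when (R ⊆ᵇ (S ∩ T)) 1#)) (≡.sym (⊥⊆ᵇ R))))
    #between-⊥ : ∀ B → #between ⊥ B a ≈ fromℕ (∣ B ∣ C a)
    #between-⊥ B = trans (#between≈ ⊥ B a) (≡⇒≈ (≡.cong₂ (λ b m → when b (fromℕ m)) (⊥⊆ᵇ B)
      (≡.cong₂ (λ c a′ → intervalCount c a′ a) (≡.cong ∣_∣ (Subsetₚ.p─⊥≡p B)) (Subsetₚ.∣⊥∣≡0 n))))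

  down-up : ∀ n a b w S →
    down n b (up n a w) S
      ≈ Σˢ n (λ T → when (∣ T ∣ ≡ᵇ a) (w T * fromℕ (intervalCount ∣ ⊤ ─ (S ∪ T) ∣ ∣ S ∪ T ∣ b)))
  down-up n a b w S = begin
    down n b (up n a w) S
      ≈⟨ ∑-when-swap (allSubsets n) (allSubsets n) (λ K → ∣ K ∣ ≡ᵇ b) (S ⊆ᵇ_)
                     (λ T → ∣ T ∣ ≡ᵇ a) (λ K T → T ⊆ᵇ K) w ⟩
    Σˢ n (λ T → when (∣ T ∣ ≡ᵇ a) (w T * Σˢ n (λ K → when (∣ K ∣ ≡ᵇ b) (when (S ⊆ᵇ K) (when (T ⊆ᵇ K) 1#)))))
      ≈⟨ Σˢ-cong n (λ T → when-cong (∣ T ∣ ≡ᵇ a)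
           (*-congˡ (Σˢ-cong n (λ K → ≡⇒≈ (≡.cong (when (∣ K ∣ ≡ᵇ b)) (∪-⊆ T K)))))) ⟩
    Σˢ n (λ T → when (∣ T ∣ ≡ᵇ a) (w T * #between (S ∪ T) ⊤ b))
      ≈⟨ Σˢ-cong n (λ T → when-cong (∣ T ∣ ≡ᵇ a) (*-congˡ (trans (#between≈ (S ∪ T) ⊤ b)
           (≡⇒≈ (≡.cong (λ c → when c (fromℕ (intervalCount ∣ ⊤ ─ (S ∪ T) ∣ ∣ S ∪ T ∣ b))) (⊆ᵇ⊤ (S ∪ T))))))) ⟩
    Σˢ n (λ T → when (∣ T ∣ ≡ᵇ a) (w T * fromℕ (intervalCount ∣ ⊤ ─ (S ∪ T) ∣ ∣ S ∪ T ∣ b))) ∎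
    where
    ∪-⊆ : ∀ T K → when (S ⊆ᵇ K) (when (T ⊆ᵇ K) 1#) ≡ when ((S ∪ T) ⊆ᵇ K) (when (K ⊆ᵇ ⊤) 1#)
    ∪-⊆ T K = ≡.trans (≡.sym (when-∧ (S ⊆ᵇ K) (T ⊆ᵇ K) 1#))
              (≡.cong₂ (λ b c → when b (when c 1#)) (∪-⊆ᵇ S T K) (≡.sym (⊆ᵇ⊤ K)))

  adj≈ : ∀ n k v K → adj n k v K ≈ Σˢ n (λ L → when (∣ L ∣ ≡ᵇ k) (when (∣ K ∩ L ∣ ≡ᵇ (k ℕ.∸ 1)) (v L)))
  adj≈ n k v K = trans (∑-filter (λ L → ∣ K ∩ L ∣ ℕ.≟ (k ℕ.∸ 1)) (kSubsets n k) v)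
                       (∑-filter (λ S → ∣ S ∣ ℕ.≟ k) (allSubsets n) _)

  *-fromℕ-+ : ∀ x m k → x * fromℕ (m ℕ.+ k) ≈ x * fromℕ m + x * fromℕ k
  *-fromℕ-+ x m k = trans (*-congˡ (fromℕ-+ m k)) (distribˡ x _ _)

  *-fromℕ-if : ∀ x b m → x * fromℕ (if b then m else 0) ≈ when b (fromℕ m * x)
  *-fromℕ-if x true  m = *-comm x (fromℕ m)
  *-fromℕ-if x false m = zeroʳ x

  up-down-on-layer : ∀ n k v (K : Subset n) → ∣ K ∣ ≡ suc k →
    up n k (down n (suc k) v) K ≈ fromℕ (suc k) * v K + adj n (suc k) v K
  up-down-on-layer n k v K ∣K∣ = begin
    up n k (down n (suc k) v) K
      ≈⟨ up-down n k (suc k) v K ⟩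
    Σˢ n (λ L → when (∣ L ∣ ≡ᵇ suc k) (v L * fromℕ (∣ K ∩ L ∣ C k)))
      ≈⟨ Σˢ-cong n split ⟩
    Σˢ n (λ L → when (K == L) (fromℕ (suc k) * v L) + when (∣ L ∣ ≡ᵇ suc k) (when (∣ K ∩ L ∣ ≡ᵇ k) (v L)))
      ≈⟨ ∑-+ (allSubsets n) _ _ ⟩
    Σˢ n (λ L → when (K == L) (fromℕ (suc k) * v L))
      + Σˢ n (λ L → when (∣ L ∣ ≡ᵇ suc k) (when (∣ K ∩ L ∣ ≡ᵇ k) (v L)))
      ≈⟨ +-cong (Σˢ-== K (λ L → fromℕ (suc k) * v L)) (sym (adj≈ n (suc k) v K)) ⟩
    fromℕ (suc k) * v K + adj n (suc k) v K ∎
    where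
    split : ∀ L → when (∣ L ∣ ≡ᵇ suc k) (v L * fromℕ (∣ K ∩ L ∣ C k))
                ≈ when (K == L) (fromℕ (suc k) * v L) + when (∣ L ∣ ≡ᵇ suc k) (when (∣ K ∩ L ∣ ≡ᵇ k) (v L))
    split L with ∣ L ∣ ≡ᵇ suc k in e
    ... | false rewrite ≢∣∣⇒==-false K L (λ ∣K∣≡∣L∣ → ≡ᵇ-false⇒≢ e (≡.trans (≡.sym ∣K∣≡∣L∣) ∣K∣))
      = sym (+-identityʳ 0#)
    ... | true = begin
      v L * fromℕ (∣ K ∩ L ∣ C k)
        ≡⟨ ≡.cong (λ m → v L * fromℕ m) (∩-binomial {K = K} {L} ∣K∣ (≡ᵇ-true⇒≡ e)) ⟩
      v L * fromℕ ((if K == L then suc k else 0) ℕ.+ (if ∣ K ∩ L ∣ ≡ᵇ k then 1 else 0))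
        ≈⟨ *-fromℕ-+ (v L) (if K == L then suc k else 0) (if ∣ K ∩ L ∣ ≡ᵇ k then 1 else 0) ⟩
      v L * fromℕ (if K == L then suc k else 0) + v L * fromℕ (if ∣ K ∩ L ∣ ≡ᵇ k then 1 else 0)
        ≈⟨ +-cong (*-fromℕ-if (v L) (K == L) (suc k)) (*-fromℕ-if (v L) (∣ K ∩ L ∣ ≡ᵇ k) 1) ⟩
      when (K == L) (fromℕ (suc k) * v L) + when (∣ K ∩ L ∣ ≡ᵇ k) ((1# + 0#) * v L)
        ≈⟨ +-congˡ (when-cong (∣ K ∩ L ∣ ≡ᵇ k) (trans (*-congʳ (+-identityʳ 1#)) (*-identityˡ (v L)))) ⟩
      when (K == L) (fromℕ (suc k) * v L) + when (∣ K ∩ L ∣ ≡ᵇ k) (v L) ∎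

  down-up-on-layer : ∀ n k d w (S : Subset n) → ∣ S ∣ ≡ suc k → d ℕ.+ suc k ≡ n →
    down n (suc (suc k)) (up n (suc k) w) S + fromℕ (suc k) * w S ≈ up n k (down n (suc k) w) S + fromℕ d * w S
  down-up-on-layer n k d w S ∣S∣ d+k+1≡n = begin
    down n (suc (suc k)) (up n (suc k) w) S + fromℕ (suc k) * w S
      ≈⟨ +-cong (down-up n (suc k) (suc (suc k)) w S) (sym (Σˢ-== S (λ T → fromℕ (suc k) * w T))) ⟩
    Σˢ n (λ T → when (∣ T ∣ ≡ᵇ suc k) (w T * fromℕ (#supersets T))) + Σˢ n (λ T → when (S == T) (fromℕ (suc k) * w T))
      ≈⟨ ∑-+ (allSubsets n) _ _ ⟨
    Σˢ n (λ T → when (∣ T ∣ ≡ᵇ suc k) (w T * fromℕ (#supersets T)) + when (S == T) (fromℕ (suc k) * w T))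
      ≈⟨ Σˢ-cong n exchange ⟩
    Σˢ n (λ T → when (∣ T ∣ ≡ᵇ suc k) (w T * fromℕ (∣ S ∩ T ∣ C k)) + when (S == T) (fromℕ d * w T))
      ≈⟨ ∑-+ (allSubsets n) _ _ ⟩
    Σˢ n (λ T → when (∣ T ∣ ≡ᵇ suc k) (w T * fromℕ (∣ S ∩ T ∣ C k))) + Σˢ n (λ T → when (S == T) (fromℕ d * w T))
      ≈⟨ +-cong (up-down n k (suc k) w S) (sym (Σˢ-== S (λ T → fromℕ d * w T))) ⟨
    up n k (down n (suc k) w) S + fromℕ d * w S ∎
    where
    #supersets : Subset n → ℕ
    #supersets T = intervalCount ∣ ⊤ ─ (S ∪ T) ∣ ∣ S ∪ T ∣ (suc (suc k))
    exchange : ∀ T → when (∣ T ∣ ≡ᵇ suc k) (w T * fromℕ (#supersets T)) + when (S == T) (fromℕ (suc k) * w T)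
                   ≈ when (∣ T ∣ ≡ᵇ suc k) (w T * fromℕ (∣ S ∩ T ∣ C k)) + when (S == T) (fromℕ d * w T)
    exchange T with ∣ T ∣ ≡ᵇ suc k in e
    ... | false rewrite ≢∣∣⇒==-false S T (λ ∣S∣≡∣T∣ → ≡ᵇ-false⇒≢ e (≡.trans (≡.sym ∣S∣≡∣T∣) ∣S∣))
      = refl
    ... | true = begin
      w T * fromℕ (#supersets T) + when (S == T) (fromℕ (suc k) * w T)
        ≈⟨ +-congˡ (*-fromℕ-if (w T) (S == T) (suc k)) ⟨
      w T * fromℕ (#supersets T) + w T * fromℕ (if S == T then suc k else 0)
        ≈⟨ *-fromℕ-+ (w T) (#supersets T) (if S == T then suc k else 0) ⟨
      w T * fromℕ (#supersets T ℕ.+ (if S == T then suc k else 0))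
        ≡⟨ ≡.cong (λ m → w T * fromℕ m) (∪-supersets S T ∣S∣ (≡ᵇ-true⇒≡ e) d+k+1≡n) ⟩
      w T * fromℕ (∣ S ∩ T ∣ C k ℕ.+ (if S == T then d else 0))
        ≈⟨ *-fromℕ-+ (w T) (∣ S ∩ T ∣ C k) (if S == T then d else 0) ⟩
      w T * fromℕ (∣ S ∩ T ∣ C k) + w T * fromℕ (if S == T then d else 0)
        ≈⟨ +-congˡ (*-fromℕ-if (w T) (S == T) d) ⟩
      w T * fromℕ (∣ S ∩ T ∣ C k) + when (S == T) (fromℕ d * w T) ∎

  up-Wᵀ : ∀ n k u (K : Subset n) → ∣ K ∣ ≡ suc k → up n k (Wᵀ n u) K ≈ fromℕ k * Wᵀ n u K
  up-Wᵀ n k u K ∣K∣ = begin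
    up n k (Wᵀ n u) K
      ≈⟨ ∑-when-swap (allSubsets n) (allFin n) (λ S → ∣ S ∣ ≡ᵇ k) (_⊆ᵇ K) (λ _ → true) lookup u ⟩
    ∑ (allFin n) (λ i → u i * Σˢ n (λ S → when (∣ S ∣ ≡ᵇ k) (when (S ⊆ᵇ K) (when (lookup S i) 1#))))
      ≈⟨ ∑-cong (allFin n) (λ i → *-congˡ (Σˢ-cong n (λ S → ≡⇒≈ (≡.cong (when (∣ S ∣ ≡ᵇ k)) (∋i-⊆ i S))))) ⟩
    ∑ (allFin n) (λ i → u i * #between ⁅ i ⁆ K k)
      ≈⟨ ∑-cong (allFin n) count ⟩
    ∑ (allFin n) (λ i → fromℕ k * when (lookup K i) (u i))
      ≈⟨ ∑-*ˡ (allFin n) (fromℕ k) _ ⟩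
    fromℕ k * Wᵀ n u K ∎
    where
    ∋i-⊆ : ∀ i S → when (S ⊆ᵇ K) (when (lookup S i) 1#) ≡ when (⁅ i ⁆ ⊆ᵇ S) (when (S ⊆ᵇ K) 1#)
    ∋i-⊆ i S = ≡.trans (when-comm (S ⊆ᵇ K) (lookup S i) 1#)
                       (≡.cong (λ b → when b (when (S ⊆ᵇ K) 1#)) (lookup≡⁅⁆⊆ᵇ S i))
    count : ∀ i → u i * #between ⁅ i ⁆ K k ≈ fromℕ k * when (lookup K i) (u i)
    count i with lookup K i in e
    ... | false = trans (*-congˡ (trans (#between≈ ⁅ i ⁆ K k) (≡⇒≈ (≡.cong (λ b → when b m) i∉K))))
                        (trans (zeroʳ (u i)) (sym (zeroʳ (fromℕ k))))
      where
      m = fromℕ (intervalCount ∣ K ─ ⁅ i ⁆ ∣ ∣ ⁅ i ⁆ ∣ k)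
      i∉K : ⁅ i ⁆ ⊆ᵇ K ≡ false
      i∉K = ≡.trans (≡.sym (lookup≡⁅⁆⊆ᵇ K i)) e
    ... | true = trans (*-congˡ (trans (#between≈ ⁅ i ⁆ K k) (≡⇒≈ (≡.cong₂ (λ b m → when b (fromℕ m)) i∈K count≡k))))
                       (*-comm (u i) (fromℕ k))
      where
      i∈K : ⁅ i ⁆ ⊆ᵇ K ≡ true
      i∈K = ≡.trans (≡.sym (lookup≡⁅⁆⊆ᵇ K i)) e
      ∣K─i∣ : ∣ K ─ ⁅ i ⁆ ∣ ≡ k
      ∣K─i∣ = ℕₚ.suc-injective (≡.trans (ℕₚ.+-comm 1 _)
                (≡.trans (≡.cong (∣ K ─ ⁅ i ⁆ ∣ ℕ.+_) (≡.sym (Subsetₚ.∣⁅x⁆∣≡1 i)))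
                         (≡.trans (∣─∣+∣∣ ⁅ i ⁆ K i∈K) ∣K∣)))
      count≡k : intervalCount ∣ K ─ ⁅ i ⁆ ∣ ∣ ⁅ i ⁆ ∣ k ≡ k
      count≡k = ≡.trans (≡.cong₂ (λ d a → intervalCount d a k) ∣K─i∣ (Subsetₚ.∣⁅x⁆∣≡1 i)) (intervalCount-1 k)

  Σˢ-empty : ∀ n (h : Subset n → Carrier) → Σˢ n (λ S → when (∣ S ∣ ≡ᵇ 0) (h S)) ≈ h ⊥
  Σˢ-empty n h = trans (Σˢ-cong n (λ S → ≡⇒≈ (≡.cong (λ b → when b (h S)) (∣∣≡ᵇ0 S)))) (Σˢ-== ⊥ h)

  up-zero : ∀ n f (K : Subset n) → up n 0 f K ≈ f ⊥
  up-zero n f K = trans (Σˢ-empty n (λ S → when (S ⊆ᵇ K) (f S))) (≡⇒≈ (≡.cong (λ b → when b (f ⊥)) (⊥⊆ᵇ K)))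

  ∑-singletons : ∀ n (g : Subset n → Carrier) →
                 ∑ (allFin n) (λ i → g ⁅ i ⁆) ≈ Σˢ n (λ L → when (∣ L ∣ ≡ᵇ 1) (g L))
  ∑-singletons zero    g = sym (+-identityʳ 0#)
  ∑-singletons (suc n) g = begin
    ∑ (allFin (suc n)) (λ i → g ⁅ i ⁆)
      ≡⟨ ∑-allFin-suc n (λ i → g ⁅ i ⁆) ⟩
    g (true ∷ ⊥) + ∑ (allFin n) (λ i → g (false ∷ ⁅ i ⁆))
      ≈⟨ +-cong (sym (Σˢ-empty n (λ L → g (true ∷ L)))) (∑-singletons n (λ L → g (false ∷ L))) ⟩
    Σˢ n (λ L → when (∣ L ∣ ≡ᵇ 0) (g (true ∷ L))) + Σˢ n (λ L → when (∣ L ∣ ≡ᵇ 1) (g (false ∷ L)))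
      ≈⟨ Σˢ-suc n _ ⟨
    Σˢ (suc n) (λ L → when (∣ L ∣ ≡ᵇ 1) (g L)) ∎

  up-cong : ∀ n j {f g : Subset n → Carrier} K → (∀ S → ∣ S ∣ ≡ j → f S ≈ g S) → up n j f K ≈ up n j g K
  up-cong n j {f} {g} K f≈g = Σˢ-cong n pointwise
    where
    pointwise : ∀ S → when (∣ S ∣ ≡ᵇ j) (when (S ⊆ᵇ K) (f S)) ≈ when (∣ S ∣ ≡ᵇ j) (when (S ⊆ᵇ K) (g S))
    pointwise S with ∣ S ∣ ≡ᵇ j in e
    ... | false = refl
    ... | true  = when-cong (S ⊆ᵇ K) (f≈g S (≡ᵇ-true⇒≡ e))

  down-cong : ∀ n j {f g : Subset n → Carrier} S → (∀ K → ∣ K ∣ ≡ j → f K ≈ g K) → down n j f S ≈ down n j g S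
  down-cong n j {f} {g} S f≈g = Σˢ-cong n pointwise
    where
    pointwise : ∀ K → when (∣ K ∣ ≡ᵇ j) (when (S ⊆ᵇ K) (f K)) ≈ when (∣ K ∣ ≡ᵇ j) (when (S ⊆ᵇ K) (g K))
    pointwise K with ∣ K ∣ ≡ᵇ j in e
    ... | false = refl
    ... | true  = when-cong (S ⊆ᵇ K) (f≈g K (≡ᵇ-true⇒≡ e))

  down-*ˡ : ∀ n j a v S → down n j (λ K → a * v K) S ≈ a * down n j v S
  down-*ˡ n j a v S = trans (Σˢ-cong n (λ K → trans (when-cong (∣ K ∣ ≡ᵇ j) (sym (when-*ˡ (S ⊆ᵇ K) a (v K))))
                                                   (sym (when-*ˡ (∣ K ∣ ≡ᵇ j) a _))))
                            (∑-*ˡ (allSubsets n) a _)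

  up-on-layer : ∀ n j v (K : Subset n) → ∣ K ∣ ≡ j → up n j v K ≈ v K
  up-on-layer n j v K ∣K∣ = trans (Σˢ-cong n only-K) (Σˢ-== K v)
    where
    only-K : ∀ S → when (∣ S ∣ ≡ᵇ j) (when (S ⊆ᵇ K) (v S)) ≈ when (K == S) (v S)
    only-K S with K == S in e
    ... | true with ==⇒≡ K S e
    ...   | ≡.refl rewrite ≡ᵇ-true ∣K∣ | ⊆ᵇ-refl K = refl
    only-K S | false with ∣ S ∣ ≡ᵇ j in e₁ | S ⊆ᵇ K in e₂
    ... | false | _     = refl
    ... | true  | false = refl
    ... | true  | true with () ← ≡.trans (≡.sym (⊆ᵇ-same-size S K e₂ (≡.trans (≡ᵇ-true⇒≡ e₁) (≡.sym ∣K∣)))) e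

  Wᵀ-*ˡ : ∀ n a u (K : Subset n) → Wᵀ n (λ i → a * u i) K ≈ a * Wᵀ n u K
  Wᵀ-*ˡ n a u K = trans (∑-cong (allFin n) (λ i → sym (when-*ˡ (lookup K i) a (u i)))) (∑-*ˡ (allFin n) a _)

  Wᵀ-singletons : ∀ n v (K : Subset n) → Wᵀ n (λ i → v ⁅ i ⁆) K ≈ up n 1 v K
  Wᵀ-singletons n v K = trans (∑-cong (allFin n) (λ i → ≡⇒≈ (≡.cong (λ b → when b (v ⁅ i ⁆)) (lookup≡⁅⁆⊆ᵇ K i))))
                              (∑-singletons n (λ L → when (L ⊆ᵇ K) (v L)))

  open IsTotalOrder ≤-isTotalOrder using (total; antisym; ≤-respˡ-≈; ≤-respʳ-≈)
    renaming (refl to ≤-refl; reflexive to ≤-reflexive; trans to ≤-trans)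

  ≤-poset : Poset ℓ ℓ₁ ℓ₂
  ≤-poset = record { isPartialOrder = IsTotalOrder.isPartialOrder ≤-isTotalOrder }

  +-monoʳ-≤ : ∀ z {x y} → x ≤ y → (z + x) ≤ (z + y)
  +-monoʳ-≤ z x≤y = ≤-respˡ-≈ (+-comm _ _) (≤-respʳ-≈ (+-comm _ _) (+-monoˡ-≤ z x≤y))

  0≤1 : 0# ≤ 1#
  0≤1 with total 0# 1#
  ... | inj₁ 0≤1 = 0≤1
  ... | inj₂ 1≤0 = ⊥-elim (0≉1 (antisym (≤-respʳ-≈ [-1][-1]≈1 (*-nonneg 0≤-1 0≤-1)) 1≤0))
    where
    0≤-1 : 0# ≤ (- 1#)
    0≤-1 = ≤-respˡ-≈ (-‿inverseʳ 1#) (≤-respʳ-≈ (+-identityˡ _) (+-monoˡ-≤ (- 1#) 1≤0))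
    [-1][-1]≈1 : - 1# * - 1# ≈ 1#
    [-1][-1]≈1 = trans (-1*x≈-x _) (-‿involutive _)

  0≤fromℕ : ∀ m → 0# ≤ fromℕ m
  0≤fromℕ zero    = ≤-refl
  0≤fromℕ (suc m) = ≤-trans 0≤1 (≤-respˡ-≈ (+-identityʳ 1#) (+-monoʳ-≤ 1# (0≤fromℕ m)))

  1≤fromℕ-suc : ∀ m → 1# ≤ fromℕ (suc m)
  1≤fromℕ-suc m = ≤-respˡ-≈ (+-identityʳ 1#) (+-monoʳ-≤ 1# (0≤fromℕ m))

  fromℕ-suc≉0 : ∀ m → ¬ (fromℕ (suc m) ≈ 0#)
  fromℕ-suc≉0 m e = 0≉1 (antisym 0≤1 (≤-respʳ-≈ e (1≤fromℕ-suc m)))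

  *-cancelˡ : ∀ {a x y} → ¬ (a ≈ 0#) → a * x ≈ a * y → x ≈ y
  *-cancelˡ {a} {x} {y} a≉0 ax≈ay with inverse a a≉0
  ... | b , ab≈1 = begin
    x             ≈⟨ *-identityˡ x ⟨
    1# * x        ≈⟨ *-congʳ (trans (*-comm b a) ab≈1) ⟨
    (b * a) * x   ≈⟨ *-assoc b a x ⟩
    b * (a * x)   ≈⟨ *-congˡ ax≈ay ⟩
    b * (a * y)   ≈⟨ *-assoc b a y ⟨
    (b * a) * y   ≈⟨ *-congʳ (trans (*-comm b a) ab≈1) ⟩
    1# * y        ≈⟨ *-identityˡ y ⟩
    y             ∎

  EigenEquation : ∀ n k → Carrier → (Subset n → Carrier) → Set ℓ₁
  EigenEquation n k θ v = ∀ K → ∣ K ∣ ≡ k → adj n k v K ≈ (θ * v K)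

  -- θ₁ n (suc k) when n = suc k + suc m
  θ₁′ : ℕ → ℕ → Carrier
  θ₁′ k m = fromℕ (k ℕ.* m) - 1#

  up-down-eigen : ∀ n k m v → EigenEquation n (suc k) (θ₁′ k m) v →
    ∀ K → ∣ K ∣ ≡ suc k → up n k (down n (suc k) v) K ≈ (fromℕ k * fromℕ (suc m)) * v K
  up-down-eigen n k m v eig K ∣K∣ = begin
    up n k (down n (suc k) v) K               ≈⟨ up-down-on-layer n k v K ∣K∣ ⟩
    fromℕ (suc k) * v K + adj n (suc k) v K  ≈⟨ +-congˡ (eig K ∣K∣) ⟩
    fromℕ (suc k) * v K + θ₁′ k m * v K      ≈⟨ distribʳ _ _ _ ⟨
    (fromℕ (suc k) + θ₁′ k m) * v K          ≈⟨ *-congʳ eigenvalue-sum ⟩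
    (fromℕ k * fromℕ (suc m)) * v K          ∎
    where
    eigenvalue-sum : fromℕ (suc k) + θ₁′ k m ≈ fromℕ k * fromℕ (suc m)
    eigenvalue-sum = begin
      (1# + fromℕ k) + (fromℕ (k ℕ.* m) - 1#)       ≈⟨ +-congˡ (+-congʳ (fromℕ-* k m)) ⟩
      (1# + fromℕ k) + (fromℕ k * fromℕ m - 1#)
        ≈⟨ solve 2 (λ a b → (con (ℤ.+ 1) :+ a) :+ (a :* b :- con (ℤ.+ 1)) := a :* (con (ℤ.+ 1) :+ b))
                   refl (fromℕ k) (fromℕ m) ⟩
      fromℕ k * (1# + fromℕ m)                       ∎

  isolate : ∀ a b d y x → a * x + b * x ≈ (b * x + y) + d * x → y ≈ (a - d) * x
  isolate a b d y x e = begin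
    y
      ≈⟨ solve 3 (λ y bx dx → y := ((bx :+ y) :+ dx) :- (bx :+ dx)) refl y (b * x) (d * x) ⟩
    ((b * x + y) + d * x) - (b * x + d * x)
      ≈⟨ +-congʳ e ⟨
    (a * x + b * x) - (b * x + d * x)
      ≈⟨ solve 4 (λ a b d x → (a :* x :+ b :* x) :- (b :* x :+ d :* x) := (a :- d) :* x) refl a b d x ⟩
    (a - d) * x ∎

  down-eigen : ∀ n k m v → n ≡ suc (suc k) ℕ.+ suc m →
    EigenEquation n (suc (suc k)) (θ₁′ (suc k) m) v → EigenEquation n (suc k) (θ₁′ k (suc m)) (down n (suc (suc k)) v)
  down-eigen n k m v n≡ eig S ∣S∣ = trans (isolate c (fromℕ (suc k)) (fromℕ (suc (suc m))) _ _ layers) (*-congʳ eigenvalue)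
    where
    w = down n (suc (suc k)) v
    c = fromℕ (suc k) * fromℕ (suc m)
    layers : c * w S + fromℕ (suc k) * w S ≈ (fromℕ (suc k) * w S + adj n (suc k) w S) + fromℕ (suc (suc m)) * w S
    layers = begin
      c * w S + fromℕ (suc k) * w S
        ≈⟨ +-congʳ (trans (down-cong n (suc (suc k)) S (up-down-eigen n (suc k) m v eig)) (down-*ˡ n (suc (suc k)) c v S)) ⟨
      down n (suc (suc k)) (up n (suc k) w) S + fromℕ (suc k) * w S
        ≈⟨ down-up-on-layer n k (suc (suc m)) w S ∣S∣
             (≡.trans (ℕₚ.+-comm (suc (suc m)) (suc k)) (≡.trans (ℕₚ.+-suc (suc k) (suc m)) (≡.sym n≡))) ⟩
      up n k (down n (suc k) w) S + fromℕ (suc (suc m)) * w S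
        ≈⟨ +-congʳ (up-down-on-layer n k w S ∣S∣) ⟩
      (fromℕ (suc k) * w S + adj n (suc k) w S) + fromℕ (suc (suc m)) * w S ∎
    eigenvalue : c - fromℕ (suc (suc m)) ≈ θ₁′ k (suc m)
    eigenvalue = begin
      (1# + fromℕ k) * (1# + fromℕ m) - (1# + (1# + fromℕ m))
        ≈⟨ solve 2 (λ a b → (con (ℤ.+ 1) :+ a) :* (con (ℤ.+ 1) :+ b) :- (con (ℤ.+ 1) :+ (con (ℤ.+ 1) :+ b))
                            := a :* (con (ℤ.+ 1) :+ b) :- con (ℤ.+ 1)) refl (fromℕ k) (fromℕ m) ⟩
      fromℕ k * (1# + fromℕ m) - 1#    ≈⟨ +-congʳ (fromℕ-* k (suc m)) ⟨
      fromℕ (k ℕ.* suc m) - 1#         ∎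

  eigenvector⇒Wᵀ : ∀ n k m → n ≡ suc k ℕ.+ suc m → ∀ v → EigenEquation n (suc k) (θ₁′ k m) v →
    ∃ λ u → (sumAll n u ≈ 0#) × (∀ K → ∣ K ∣ ≡ suc k → Wᵀ n u K ≈ v K)
  eigenvector⇒Wᵀ n zero m ≡.refl v eig = (λ i → v ⁅ i ⁆) , sum≈0 , Wᵀ≈v
    where
    K₀ = ⁅ Fin.zero {suc m} ⁆
    sum≈0 : sumAll n (λ i → v ⁅ i ⁆) ≈ 0#
    sum≈0 = begin
      ∑ (allFin n) (λ i → v ⁅ i ⁆)                 ≈⟨ ∑-singletons n v ⟩
      Σˢ n (λ L → when (∣ L ∣ ≡ᵇ 1) (v L))
        ≈⟨ Σˢ-cong n (λ L → ≡⇒≈ (≡.cong (λ b → when (∣ L ∣ ≡ᵇ 1) (when b (v L))) (⊥⊆ᵇ L))) ⟨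
      down n 1 v ⊥                                 ≈⟨ up-zero n (down n 1 v) K₀ ⟨
      up n 0 (down n 1 v) K₀                       ≈⟨ up-down-eigen n 0 m v eig K₀ (Subsetₚ.∣⁅x⁆∣≡1 (Fin.zero {suc m})) ⟩
      (0# * fromℕ (suc m)) * v K₀                  ≈⟨ trans (*-congʳ (zeroˡ _)) (zeroˡ _) ⟩
      0#                                           ∎
    Wᵀ≈v : ∀ K → ∣ K ∣ ≡ 1 → Wᵀ n (λ i → v ⁅ i ⁆) K ≈ v K
    Wᵀ≈v K ∣K∣ = trans (Wᵀ-singletons n v K) (up-on-layer n 1 v K ∣K∣)
  eigenvector⇒Wᵀ n (suc k) m n≡ v eig = u , sum≈0 , Wᵀ≈v
    where
    w = down n (suc (suc k)) v
    n≡′ : n ≡ suc k ℕ.+ suc (suc m)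
    n≡′ = ≡.trans n≡ (≡.cong suc (≡.sym (ℕₚ.+-suc k (suc m))))
    IH = eigenvector⇒Wᵀ n k (suc m) n≡′ w (down-eigen n k m v n≡ eig)
    u′ = proj₁ IH
    Wᵀu′≈w = proj₂ (proj₂ IH)
    Wᵀu′≈[m+1]v : ∀ K → ∣ K ∣ ≡ suc (suc k) → Wᵀ n u′ K ≈ fromℕ (suc m) * v K
    Wᵀu′≈[m+1]v K ∣K∣ = *-cancelˡ (fromℕ-suc≉0 k) (begin
      fromℕ (suc k) * Wᵀ n u′ K               ≈⟨ up-Wᵀ n (suc k) u′ K ∣K∣ ⟨
      up n (suc k) (Wᵀ n u′) K                ≈⟨ up-cong n (suc k) K Wᵀu′≈w ⟩
      up n (suc k) w K                        ≈⟨ up-down-eigen n (suc k) m v eig K ∣K∣ ⟩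
      (fromℕ (suc k) * fromℕ (suc m)) * v K   ≈⟨ *-assoc _ _ _ ⟩
      fromℕ (suc k) * (fromℕ (suc m) * v K)   ∎)
    y = proj₁ (inverse (fromℕ (suc m)) (fromℕ-suc≉0 m))
    [m+1]y≈1 = proj₂ (inverse (fromℕ (suc m)) (fromℕ-suc≉0 m))
    u : Fin n → Carrier
    u i = y * u′ i
    sum≈0 : sumAll n u ≈ 0#
    sum≈0 = trans (∑-*ˡ (allFin n) y u′) (trans (*-congˡ (proj₁ (proj₂ IH))) (zeroʳ y))
    Wᵀ≈v : ∀ K → ∣ K ∣ ≡ suc (suc k) → Wᵀ n u K ≈ v K
    Wᵀ≈v K ∣K∣ = begin
      Wᵀ n u K                        ≈⟨ Wᵀ-*ˡ n y u′ K ⟩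
      y * Wᵀ n u′ K                   ≈⟨ *-congˡ (Wᵀu′≈[m+1]v K ∣K∣) ⟩
      y * (fromℕ (suc m) * v K)       ≈⟨ *-assoc _ _ _ ⟨
      (y * fromℕ (suc m)) * v K       ≈⟨ *-congʳ (trans (*-comm _ _) [m+1]y≈1) ⟩
      1# * v K                        ≈⟨ *-identityˡ _ ⟩
      v K                             ∎

  open import Relation.Binary.Properties.Poset ≤-poset using (<-respʳ-≈; <-respˡ-≈; <⇒≱)

  ≤-<-trans : ∀ {x y z} → x ≤ y → y < z → x < z
  ≤-<-trans x≤y (y≤z , y≉z) = ≤-trans x≤y y≤z , λ x≈z → y≉z (antisym y≤z (≤-respˡ-≈ x≈z x≤y))

  +-monoˡ-< : ∀ z {x y} → x < y → (x + z) < (y + z)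
  +-monoˡ-< z (x≤y , x≉y) = +-monoˡ-≤ z x≤y , λ e → x≉y (+-cancelʳ z _ _ e)

  +-cancelˡ-< : ∀ z {x y} → (z + x) < (z + y) → x < y
  +-cancelˡ-< z {x} {y} (z+x≤z+y , z+x≉z+y) =
    ≤-respˡ-≈ (-z+[z+w]≈w x) (≤-respʳ-≈ (-z+[z+w]≈w y) (+-monoʳ-≤ (- z) z+x≤z+y)) , λ e → z+x≉z+y (+-congˡ e)
    where
    -z+[z+w]≈w : ∀ w → - z + (z + w) ≈ w
    -z+[z+w]≈w w = trans (sym (+-assoc _ _ _)) (trans (+-congʳ (-‿inverseˡ z)) (+-identityˡ w))

  fromℤ-+1 : ∀ a → fromℤ (a ℤ.+ ℤ.1ℤ) ≈ fromℤ a + 1#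
  fromℤ-+1 a = trans (fromℤ-+ a ℤ.1ℤ) (+-congˡ (+-identityʳ 1#))

  fromℤ-unit-interval : ∀ d → fromℤ d < 1# → (- fromℤ d) < 1# → d ≡ ℤ.0ℤ
  fromℤ-unit-interval (ℤ.+ zero)  _  _  = ≡.refl
  fromℤ-unit-interval (ℤ.+ suc m) d<1 _ = ⊥-elim (<⇒≱ d<1 (1≤fromℕ-suc m))
  fromℤ-unit-interval -[1+ m ]    _ -d<1 = ⊥-elim (<⇒≱ -d<1 (≤-respʳ-≈ (sym (-‿involutive _)) (1≤fromℕ-suc m)))

  ⌊⌋-unique : ∀ a x → fromℤ a ≤ x → x < fromℤ (a ℤ.+ ℤ.1ℤ) → ⌊ x ⌋ ≡ a
  ⌊⌋-unique a x a≤x x<a+1 =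
    ≡.trans (≡.sym (ℤₚ.+-identityʳ b)) (≡.trans (≡.cong (λ i → b ℤ.+ i) (≡.sym d≡0)) (≡.sym (b+[a-b]≡a a b)))
    where
    b = ⌊ x ⌋
    d = a ℤ.- b
    b+[a-b]≡a : ∀ a b → a ≡ b ℤ.+ (a ℤ.- b)
    b+[a-b]≡a = solve-∀
    a≈b+d : fromℤ a ≈ fromℤ b + fromℤ d
    a≈b+d = trans (≡⇒≈ (≡.cong fromℤ (b+[a-b]≡a a b))) (fromℤ-+ b d)
    b≈a-d : fromℤ b ≈ fromℤ a + (- fromℤ d)
    b≈a-d = trans (solve 2 (λ b d → b := (b :+ d) :- d) refl (fromℤ b) (fromℤ d)) (+-congʳ (sym a≈b+d))
    d≡0 : d ≡ ℤ.0ℤ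
    d≡0 = fromℤ-unit-interval d
      (+-cancelˡ-< (fromℤ b) (<-respˡ-≈ a≈b+d (<-respʳ-≈ (fromℤ-+1 b) (≤-<-trans a≤x (<-⌊⌋+1 x)))))
      (+-cancelˡ-< (fromℤ a) (<-respˡ-≈ b≈a-d (<-respʳ-≈ (fromℤ-+1 a) (≤-<-trans (⌊⌋-≤ x) x<a+1))))

  ⌊⌋-cong : ∀ {x y} → x ≈ y → ⌊ x ⌋ ≡ ⌊ y ⌋
  ⌊⌋-cong {x} {y} x≈y = ≡.sym (⌊⌋-unique ⌊ x ⌋ y (≤-respʳ-≈ x≈y (⌊⌋-≤ x)) (<-respˡ-≈ x≈y (<-⌊⌋+1 x)))

  frac-cong : ∀ {x y} → x ≈ y → frac x ≈ frac y
  frac-cong x≈y = +-cong x≈y (-‿cong (≡⇒≈ (≡.cong fromℤ (⌊⌋-cong x≈y))))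

  ⌊+fromℤ⌋ : ∀ x i → ⌊ x + fromℤ i ⌋ ≡ ⌊ x ⌋ ℤ.+ i
  ⌊+fromℤ⌋ x i = ⌊⌋-unique (⌊ x ⌋ ℤ.+ i) (x + fromℤ i) lower upper
    where
    lower : fromℤ (⌊ x ⌋ ℤ.+ i) ≤ (x + fromℤ i)
    lower = ≤-respˡ-≈ (sym (fromℤ-+ ⌊ x ⌋ i)) (+-monoˡ-≤ (fromℤ i) (⌊⌋-≤ x))
    [a+1]+i≡[a+i]+1 : ∀ a i → (a ℤ.+ ℤ.1ℤ) ℤ.+ i ≡ (a ℤ.+ i) ℤ.+ ℤ.1ℤ
    [a+1]+i≡[a+i]+1 = solve-∀
    upper : (x + fromℤ i) < fromℤ ((⌊ x ⌋ ℤ.+ i) ℤ.+ ℤ.1ℤ)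
    upper = <-respʳ-≈ (trans (sym (fromℤ-+ (⌊ x ⌋ ℤ.+ ℤ.1ℤ) i)) (≡⇒≈ (≡.cong fromℤ ([a+1]+i≡[a+i]+1 ⌊ x ⌋ i))))
                      (+-monoˡ-< (fromℤ i) (<-⌊⌋+1 x))

  frac-+-fromℤ : ∀ x i → frac (x + fromℤ i) ≈ frac x
  frac-+-fromℤ x i = begin
    (x + fromℤ i) - fromℤ ⌊ x + fromℤ i ⌋      ≡⟨ ≡.cong (λ j → (x + fromℤ i) - fromℤ j) (⌊+fromℤ⌋ x i) ⟩
    (x + fromℤ i) - fromℤ (⌊ x ⌋ ℤ.+ i)        ≈⟨ +-congˡ (-‿cong (fromℤ-+ ⌊ x ⌋ i)) ⟩
    (x + fromℤ i) - (fromℤ ⌊ x ⌋ + fromℤ i)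
      ≈⟨ solve 3 (λ x i a → (x :+ i) :- (a :+ i) := x :- a) refl x (fromℤ i) (fromℤ ⌊ x ⌋) ⟩
    x - fromℤ ⌊ x ⌋                            ∎

  0≤frac : ∀ x → 0# ≤ frac x
  0≤frac x = ≤-respˡ-≈ (-‿inverseʳ (fromℤ ⌊ x ⌋)) (+-monoˡ-≤ (- fromℤ ⌊ x ⌋) (⌊⌋-≤ x))

  frac<1 : ∀ x → frac x < 1#
  frac<1 x = <-respʳ-≈ (trans (+-congʳ (fromℤ-+1 ⌊ x ⌋)) (solve 2 (λ a o → (a :+ o) :- a := o) refl (fromℤ ⌊ x ⌋) 1#))
                       (+-monoˡ-< (- fromℤ ⌊ x ⌋) (<-⌊⌋+1 x))

  Integral : Carrier → Set ℓ₁
  Integral x = ∃ λ (i : ℤ) → x ≈ fromℤ i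

  Integral-cong : ∀ {x y} → x ≈ y → Integral x → Integral y
  Integral-cong x≈y (i , x≈i) = i , trans (sym x≈y) x≈i

  Integral-fromℤ : ∀ i → Integral (fromℤ i)
  Integral-fromℤ i = i , refl

  Integral-+ : ∀ {x y} → Integral x → Integral y → Integral (x + y)
  Integral-+ (i , x≈i) (j , y≈j) = i ℤ.+ j , trans (+-cong x≈i y≈j) (sym (fromℤ-+ i j))

  Integral-neg : ∀ {x} → Integral x → Integral (- x)
  Integral-neg (i , x≈i) = ℤ.- i , trans (-‿cong x≈i) (sym (fromℤ-neg i))

  Integral-fromℕ* : ∀ m {x} → Integral x → Integral (fromℕ m * x)
  Integral-fromℕ* m (i , x≈i) = ℤ.+ m ℤ.* i , trans (*-congˡ x≈i) (sym (fromℤ-* (ℤ.+ m) i))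

  Integral-∑ : {A : Set} (xs : List A) {f : A → Carrier} → (∀ x → Integral (f x)) → Integral (∑ xs f)
  Integral-∑ []       _     = Integral-fromℤ ℤ.0ℤ
  Integral-∑ (x ∷ xs) f-int = Integral-+ (f-int x) (Integral-∑ xs f-int)

  Integral-when : ∀ b {x} → Integral x → Integral (when b x)
  Integral-when true  x-int = x-int
  Integral-when false _     = Integral-fromℤ ℤ.0ℤ

  Wᵀ-∷ : ∀ n u b (K : Subset n) → Wᵀ (suc n) u (b ∷ K) ≡ when b (u Fin.zero) + Wᵀ n (λ i → u (Fin.suc i)) K
  Wᵀ-∷ n u b K = ∑-allFin-suc n _

  Wᵀ-∪⁅⁆ : ∀ n u (R : Subset n) i → lookup R i ≡ false → Wᵀ n u (R ∪ ⁅ i ⁆) ≈ Wᵀ n u R + u i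
  Wᵀ-∪⁅⁆ (suc n) u (false ∷ R) Fin.zero    _ = begin
    Wᵀ (suc n) u (true ∷ (R ∪ ⊥))                    ≡⟨ Wᵀ-∷ n u true (R ∪ ⊥) ⟩
    u Fin.zero + Wᵀ n u′ (R ∪ ⊥)                     ≡⟨ ≡.cong (λ S → u Fin.zero + Wᵀ n u′ S) (Subsetₚ.∪-identityʳ R) ⟩
    u Fin.zero + Wᵀ n u′ R                           ≈⟨ +-comm _ _ ⟩
    Wᵀ n u′ R + u Fin.zero                           ≈⟨ +-congʳ (+-identityˡ _) ⟨
    (0# + Wᵀ n u′ R) + u Fin.zero                    ≡⟨ ≡.cong (_+ u Fin.zero) (Wᵀ-∷ n u false R) ⟨
    Wᵀ (suc n) u (false ∷ R) + u Fin.zero            ∎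
    where u′ = λ i → u (Fin.suc i)
  Wᵀ-∪⁅⁆ (suc n) u (b ∷ R) (Fin.suc i) e = begin
    Wᵀ (suc n) u ((b ∷ R) ∪ (false ∷ ⁅ i ⁆))         ≡⟨ ≡.cong (Wᵀ (suc n) u) (≡.cong (_∷ (R ∪ ⁅ i ⁆)) (Boolₚ.∨-identityʳ b)) ⟩
    Wᵀ (suc n) u (b ∷ (R ∪ ⁅ i ⁆))                   ≡⟨ Wᵀ-∷ n u b (R ∪ ⁅ i ⁆) ⟩
    when b (u Fin.zero) + Wᵀ n u′ (R ∪ ⁅ i ⁆)        ≈⟨ +-congˡ (Wᵀ-∪⁅⁆ n u′ R i e) ⟩
    when b (u Fin.zero) + (Wᵀ n u′ R + u′ i)         ≈⟨ +-assoc _ _ _ ⟨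
    (when b (u Fin.zero) + Wᵀ n u′ R) + u′ i         ≡⟨ ≡.cong (_+ u′ i) (Wᵀ-∷ n u b R) ⟨
    Wᵀ (suc n) u (b ∷ R) + u′ i                      ∎
    where u′ = λ i → u (Fin.suc i)

  Wᵀ-+ : ∀ n f g (K : Subset n) → Wᵀ n (λ i → f i + g i) K ≈ Wᵀ n f K + Wᵀ n g K
  Wᵀ-+ n f g K = trans (∑-cong (allFin n) (λ i → when-+ (lookup K i) (f i) (g i))) (∑-+ (allFin n) _ _)

  Wᵀ-const : ∀ n x (K : Subset n) → Wᵀ n (λ _ → x) K ≈ fromℕ ∣ K ∣ * x
  Wᵀ-const zero    x []          = sym (zeroˡ x)
  Wᵀ-const (suc n) x (true ∷ K)  = begin
    Wᵀ (suc n) (λ _ → x) (true ∷ K)   ≡⟨ Wᵀ-∷ n (λ _ → x) true K ⟩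
    x + Wᵀ n (λ _ → x) K              ≈⟨ +-cong (sym (*-identityˡ x)) (Wᵀ-const n x K) ⟩
    1# * x + fromℕ ∣ K ∣ * x           ≈⟨ distribʳ _ _ _ ⟨
    fromℕ (suc ∣ K ∣) * x              ∎
  Wᵀ-const (suc n) x (false ∷ K) =
    trans (≡⇒≈ (Wᵀ-∷ n (λ _ → x) false K)) (trans (+-identityˡ _) (Wᵀ-const n x K))

  sumAll≈Wᵀ⊤ : ∀ n u → sumAll n u ≈ Wᵀ n u ⊤
  sumAll≈Wᵀ⊤ n u = ∑-cong (allFin n) (λ i → ≡⇒≈ (≡.cong (λ b → when b (u i)) (≡.sym (Vecₚ.lookup-replicate i true))))

  -- Wᵀ u (R ∪ ⁅ i ⁆) - Wᵀ u (R ∪ ⁅ j ⁆) = u i - u j for a set R avoiding i and j.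
  Wᵀ-integral⇒difference-integral : ∀ n k u → suc k ℕ.< n →
    (∀ K → ∣ K ∣ ≡ suc k → Integral (Wᵀ n u K)) → ∀ i j → Integral (u i - u j)
  Wᵀ-integral⇒difference-integral n k u k+1<n Wᵀ-int i j =
    Integral-cong difference
      (Integral-+ (Wᵀ-int (R ∪ ⁅ i ⁆) (∣R∪⁅⁆∣ i i∉R)) (Integral-neg (Wᵀ-int (R ∪ ⁅ j ⁆) (∣R∪⁅⁆∣ j j∉R))))
    where
    k+∣ij∣≤n : k ℕ.+ ∣ ⁅ i ⁆ ∪ ⁅ j ⁆ ∣ ℕ.≤ n
    k+∣ij∣≤n = ℕₚ.≤-trans (ℕₚ.+-monoʳ-≤ k (∣⁅⁆∪⁅⁆∣≤2 i j)) (≡.subst (ℕ._≤ n) (ℕₚ.+-comm 2 k) k+1<n)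
    R = proj₁ (disjoint-subset n (⁅ i ⁆ ∪ ⁅ j ⁆) k k+∣ij∣≤n)
    ∣R∣ = proj₁ (proj₂ (disjoint-subset n (⁅ i ⁆ ∪ ⁅ j ⁆) k k+∣ij∣≤n))
    R∌ = proj₂ (proj₂ (disjoint-subset n (⁅ i ⁆ ∪ ⁅ j ⁆) k k+∣ij∣≤n))
    i∉R : lookup R i ≡ false
    i∉R = R∌ i (≡.trans (Vecₚ.lookup-zipWith _∨_ i ⁅ i ⁆ ⁅ j ⁆) (≡.cong (_∨ lookup ⁅ j ⁆ i) (lookup⁅⁆ i)))
    j∉R : lookup R j ≡ false
    j∉R = R∌ j (≡.trans (Vecₚ.lookup-zipWith _∨_ j ⁅ i ⁆ ⁅ j ⁆)
                        (≡.trans (≡.cong (lookup ⁅ i ⁆ j ∨_) (lookup⁅⁆ j)) (Boolₚ.∨-zeroʳ _)))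
    ∣R∪⁅⁆∣ : ∀ p → lookup R p ≡ false → ∣ R ∪ ⁅ p ⁆ ∣ ≡ suc k
    ∣R∪⁅⁆∣ p p∉R = ≡.trans (∣∪⁅⁆∣ R p p∉R) (≡.cong suc ∣R∣)
    difference : Wᵀ n u (R ∪ ⁅ i ⁆) - Wᵀ n u (R ∪ ⁅ j ⁆) ≈ u i - u j
    difference = begin
      Wᵀ n u (R ∪ ⁅ i ⁆) - Wᵀ n u (R ∪ ⁅ j ⁆)   ≈⟨ +-cong (Wᵀ-∪⁅⁆ n u R i i∉R) (-‿cong (Wᵀ-∪⁅⁆ n u R j j∉R)) ⟩
      (Wᵀ n u R + u i) - (Wᵀ n u R + u j)     ≈⟨ solve 3 (λ w x y → (w :+ x) :- (w :+ y) := x :- y) refl (Wᵀ n u R) (u i) (u j) ⟩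
      u i - u j                               ∎

  frac-equal : ∀ {x y} → Integral (x - y) → frac x ≈ frac y
  frac-equal {x} {y} (i , x-y≈i) = trans (frac-cong x≈y+i) (frac-+-fromℤ y i)
    where
    x≈y+i : x ≈ y + fromℤ i
    x≈y+i = trans (solve 2 (λ x y → x := y :+ (x :- y)) refl x y) (+-congˡ x-y≈i)

  Integral-∣∣*frac : ∀ n u f → (∀ p → frac (u p) ≈ f) → ∀ K → Integral (Wᵀ n u K) → Integral (fromℕ ∣ K ∣ * f)
  Integral-∣∣*frac n u f frac≈f K Wᵀ-int = Integral-cong Wᵀ-⌊⌋≈∣K∣f (Integral-+ Wᵀ-int (Integral-neg Wᵀ-⌊⌋-int))
    where
    ⌊u⌋ : Fin n → Carrier
    ⌊u⌋ p = fromℤ ⌊ u p ⌋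
    u≈⌊u⌋+f : ∀ p → u p ≈ ⌊u⌋ p + f
    u≈⌊u⌋+f p = trans (solve 2 (λ x a → x := a :+ (x :- a)) refl (u p) (⌊u⌋ p)) (+-congˡ (frac≈f p))
    Wᵀ-⌊⌋-int : Integral (Wᵀ n ⌊u⌋ K)
    Wᵀ-⌊⌋-int = Integral-∑ (allFin n) (λ p → Integral-when (lookup K p) (Integral-fromℤ ⌊ u p ⌋))
    Wᵀ-⌊⌋≈∣K∣f : Wᵀ n u K - Wᵀ n ⌊u⌋ K ≈ fromℕ ∣ K ∣ * f
    Wᵀ-⌊⌋≈∣K∣f = begin
      Wᵀ n u K - Wᵀ n ⌊u⌋ K
        ≈⟨ +-congʳ (∑-cong (allFin n) (λ p → when-cong (lookup K p) (u≈⌊u⌋+f p))) ⟩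
      Wᵀ n (λ p → ⌊u⌋ p + f) K - Wᵀ n ⌊u⌋ K
        ≈⟨ +-congʳ (trans (Wᵀ-+ n ⌊u⌋ (λ _ → f) K) (+-congˡ (Wᵀ-const n f K))) ⟩
      (Wᵀ n ⌊u⌋ K + fromℕ ∣ K ∣ * f) - Wᵀ n ⌊u⌋ K
        ≈⟨ solve 2 (λ a b → (a :+ b) :- a := b) refl (Wᵀ n ⌊u⌋ K) (fromℕ ∣ K ∣ * f) ⟩
      fromℕ ∣ K ∣ * f ∎

  Integral-multiple : ∀ x a f → Integral (fromℕ a * f) → Integral (fromℕ (x ℕ.* a) * f)
  Integral-multiple x a f af-int =
    Integral-cong (trans (sym (*-assoc _ _ _)) (*-congʳ (sym (fromℕ-* x a)))) (Integral-fromℕ* x af-int)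

  Integral-difference : ∀ g c d f → g ℕ.+ d ≡ c → Integral (fromℕ c * f) → Integral (fromℕ d * f) → Integral (fromℕ g * f)
  Integral-difference g c d f g+d≡c cf-int df-int = Integral-cong cf-df≈gf (Integral-+ cf-int (Integral-neg df-int))
    where
    cf-df≈gf : fromℕ c * f - fromℕ d * f ≈ fromℕ g * f
    cf-df≈gf = begin
      fromℕ c * f - fromℕ d * f               ≡⟨ ≡.cong (λ m → fromℕ m * f - fromℕ d * f) (≡.sym g+d≡c) ⟩
      fromℕ (g ℕ.+ d) * f - fromℕ d * f       ≈⟨ +-congʳ (*-congʳ (fromℕ-+ g d)) ⟩
      (fromℕ g + fromℕ d) * f - fromℕ d * f   ≈⟨ solve 3 (λ x y z → (x :+ y) :* z :- y :* z := x :* z) refl _ _ _ ⟩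
      fromℕ g * f                             ∎

  Integral-gcd* : ∀ a b f → Integral (fromℕ a * f) → Integral (fromℕ b * f) → Integral (fromℕ (gcd a b) * f)
  Integral-gcd* a b f af-int bf-int with Bézout.identity (gcd-GCD a b)
  ... | Bézout.+- x y g+yb≡xa =
    Integral-difference (gcd a b) (x ℕ.* a) (y ℕ.* b) f g+yb≡xa (Integral-multiple x a f af-int) (Integral-multiple y b f bf-int)
  ... | Bézout.-+ x y g+xa≡yb =
    Integral-difference (gcd a b) (y ℕ.* b) (x ℕ.* a) f g+xa≡yb (Integral-multiple y b f bf-int) (Integral-multiple x a f af-int)

  fromℕ-mono-≤ : ∀ {a b} → a ℕ.≤ b → fromℕ a ≤ fromℕ b
  fromℕ-mono-≤ {a} a≤b with ℕₚ.m≤n⇒∃[o]m+o≡n a≤b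
  ... | o , ≡.refl = ≤-respʳ-≈ (sym (fromℕ-+ a o)) (≤-respˡ-≈ (+-identityʳ _) (+-monoʳ-≤ (fromℕ a) (0≤fromℕ o)))

  x≤y⇒0≤y-x : ∀ {x y} → x ≤ y → 0# ≤ (y - x)
  x≤y⇒0≤y-x {x} x≤y = ≤-respˡ-≈ (-‿inverseʳ x) (+-monoˡ-≤ (- x) x≤y)

  0≤y-x⇒x≤y : ∀ {x y} → 0# ≤ (y - x) → x ≤ y
  0≤y-x⇒x≤y {x} {y} 0≤y-x =
    ≤-respˡ-≈ (+-identityˡ x) (≤-respʳ-≈ (solve 2 (λ x y → (y :- x) :+ x := y) refl x y) (+-monoˡ-≤ x 0≤y-x))

  *-<-unit : ∀ g {f} → f < 1# → (fromℕ (suc g) * f) < fromℕ (suc g)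
  *-<-unit g {f} (f≤1 , f≉1) =
    0≤y-x⇒x≤y 0≤G-Gf , λ Gf≈G → f≉1 (*-cancelˡ (fromℕ-suc≉0 g) (trans Gf≈G (sym (*-identityʳ G))))
    where
    G = fromℕ (suc g)
    0≤G-Gf : 0# ≤ (G - G * f)
    0≤G-Gf = ≤-respʳ-≈ (solve 2 (λ G f → G :* (con (ℤ.+ 1) :- f) := G :- G :* f) refl G f)
                       (*-nonneg (0≤fromℕ (suc g)) (x≤y⇒0≤y-x f≤1))

  ¬0≤-fromℕ-suc : ∀ q → ¬ (0# ≤ (- fromℕ (suc q)))
  ¬0≤-fromℕ-suc q 0≤-q = 0≉1 (antisym 0≤1 (≤-trans (1≤fromℕ-suc q) q≤0))
    where
    q≤0 : fromℕ (suc q) ≤ 0#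
    q≤0 = 0≤y-x⇒x≤y (≤-respʳ-≈ (sym (+-identityˡ _)) 0≤-q)

  integral-multiple-of-unit-interval : ∀ g {f} → 0# ≤ f → f < 1# → Integral (fromℕ (suc g) * f) →
    ∃ λ t → (t ℕ.< suc g) × (fromℕ (suc g) * f ≈ fromℕ t)
  integral-multiple-of-unit-interval g 0≤f f<1 (ℤ.+ t , Gf≈t) =
    t , ℕₚ.≰⇒> (λ g+1≤t → <⇒≱ (*-<-unit g f<1) (≤-trans (fromℕ-mono-≤ g+1≤t) (≤-reflexive (sym Gf≈t)))) , Gf≈t
  integral-multiple-of-unit-interval g 0≤f f<1 (-[1+ q ] , Gf≈-q) =
    ⊥-elim (¬0≤-fromℕ-suc q (≤-respʳ-≈ Gf≈-q (*-nonneg (0≤fromℕ (suc g)) 0≤f)))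

  fraction-in-lowest-terms : ∀ g {f} → g ≢ 0 → 0# ≤ f → f < 1# → Integral (fromℕ g * f) →
    ∃₂ λ r s → (r ℕ.< s) × (gcd r s ≡ 1) × (s ∣ g) × (f * fromℕ s ≈ fromℕ r)
  fraction-in-lowest-terms zero    0≢0 _ _ _ = ⊥-elim (0≢0 ≡.refl)
  fraction-in-lowest-terms (suc g) {f} _ 0≤f f<1 gf-int
    with t , t<g , gf≈t ← integral-multiple-of-unit-interval g 0≤f f<1 gf-int
    with r , s , d , r<s , gcd≡1 , t≡r[d+1] , g≡s[d+1] ← lowest-terms t (suc g) t<g
    = r , s , r<s , gcd≡1 , divides (suc d) (≡.trans g≡s[d+1] (ℕₚ.*-comm s (suc d))) ,
      *-cancelˡ (fromℕ-suc≉0 d) (begin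
        fromℕ (suc d) * (f * fromℕ s)   ≈⟨ solve 3 (λ D f s → D :* (f :* s) := (s :* D) :* f) refl _ f _ ⟩
        (fromℕ s * fromℕ (suc d)) * f   ≈⟨ *-congʳ (fromℕ-* s (suc d)) ⟨
        fromℕ (s ℕ.* suc d) * f         ≡⟨ ≡.cong (λ m → fromℕ m * f) g≡s[d+1] ⟨
        fromℕ (suc g) * f               ≈⟨ gf≈t ⟩
        fromℕ t                         ≡⟨ ≡.cong fromℕ t≡r[d+1] ⟩
        fromℕ (r ℕ.* suc d)             ≈⟨ fromℕ-* r (suc d) ⟩
        fromℕ r * fromℕ (suc d)         ≈⟨ *-comm _ _ ⟩
        fromℕ (suc d) * fromℕ r         ∎)

  Wᵀ-integral⇒frac-equal : ∀ n k u → suc k ℕ.< n → (∀ K → ∣ K ∣ ≡ suc k → Integral (Wᵀ n u K)) →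
    ∀ i j → frac (u i) ≈ frac (u j)
  Wᵀ-integral⇒frac-equal n k u k+1<n Wᵀ-int i j = frac-equal (Wᵀ-integral⇒difference-integral n k u k+1<n Wᵀ-int i j)

  -- With f the common fractional part, Wᵀ u K₀ ∈ ℤ for a k-set K₀ gives k f ∈ ℤ,
  -- and ∑ u = 0 gives n f ∈ ℤ.
  Wᵀ-integral⇒gcd*frac-integral : ∀ n k u → suc k ℕ.< suc n → sumAll (suc n) u ≈ 0# →
    (∀ K → ∣ K ∣ ≡ suc k → Integral (Wᵀ (suc n) u K)) → Integral (fromℕ (gcd (suc n) (suc k)) * frac (u Fin.zero))
  Wᵀ-integral⇒gcd*frac-integral n k u k+1<n sum≈0 Wᵀ-int = Integral-gcd* (suc n) (suc k) f nf-int kf-int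
    where
    f = frac (u Fin.zero)
    frac≈f : ∀ p → frac (u p) ≈ f
    frac≈f p = Wᵀ-integral⇒frac-equal (suc n) k u k+1<n Wᵀ-int p Fin.zero
    k-set = disjoint-subset (suc n) ⊥ (suc k)
      (≡.subst (λ m → suc k ℕ.+ m ℕ.≤ suc n) (≡.sym (Subsetₚ.∣⊥∣≡0 (suc n)))
               (≡.subst (ℕ._≤ suc n) (≡.sym (ℕₚ.+-identityʳ (suc k))) (ℕₚ.<⇒≤ k+1<n)))
    K₀ = proj₁ k-set
    ∣K₀∣ = proj₁ (proj₂ k-set)
    kf-int : Integral (fromℕ (suc k) * f)
    kf-int = ≡.subst (λ m → Integral (fromℕ m * f)) ∣K₀∣ (Integral-∣∣*frac (suc n) u f frac≈f K₀ (Wᵀ-int K₀ ∣K₀∣))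
    nf-int : Integral (fromℕ (suc n) * f)
    nf-int = ≡.subst (λ m → Integral (fromℕ m * f)) (Subsetₚ.∣⊤∣≡n (suc n))
      (Integral-∣∣*frac (suc n) u f frac≈f ⊤
        (Integral-cong (trans (sym sum≈0) (sumAll≈Wᵀ⊤ (suc n) u)) (Integral-fromℤ ℤ.0ℤ)))

  integral-Wᵀ⇒common-fraction : ∀ n k u → suc k ℕ.< n → sumAll n u ≈ 0# →
    (∀ K → ∣ K ∣ ≡ suc k → Integral (Wᵀ n u K)) →
    (∀ i j → frac (u i) ≈ frac (u j)) ×
    ∃₂ λ r s → (r ℕ.< s) × (gcd r s ≡ 1) × (s ∣ gcd n (suc k)) × (∀ i → (frac (u i) * fromℕ s) ≈ fromℕ r)
  integral-Wᵀ⇒common-fraction (suc n) k u k+1<n sum≈0 Wᵀ-int = frac-equal′ , spread (fraction-in-lowest-terms (gcd (suc n) (suc k))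
    (gcd[m,n]≢0 (suc n) (suc k) (inj₁ (λ ()))) (0≤frac (u Fin.zero)) (frac<1 (u Fin.zero))
    (Wᵀ-integral⇒gcd*frac-integral n k u k+1<n sum≈0 Wᵀ-int))
    where
    frac-equal′ = Wᵀ-integral⇒frac-equal (suc n) k u k+1<n Wᵀ-int
    spread : ∀ {g} → (∃₂ λ r s → (r ℕ.< s) × (gcd r s ≡ 1) × (s ∣ g) × (frac (u Fin.zero) * fromℕ s ≈ fromℕ r)) →
             ∃₂ λ r s → (r ℕ.< s) × (gcd r s ≡ 1) × (s ∣ g) × (∀ i → (frac (u i) * fromℕ s) ≈ fromℕ r)
    spread (r , s , r<s , gcd≡1 , s∣g , fs≈r) = r , s , r<s , gcd≡1 , s∣g , λ i → trans (*-congʳ (frac-equal′ i Fin.zero)) fs≈r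

  fromℤ-θ₁ : ∀ k m → fromℤ (θ₁ (suc (suc k) ℕ.+ m) (suc k)) ≈ θ₁′ k m
  fromℤ-θ₁ k m =
    trans (≡⇒≈ (≡.cong fromℤ (θ₁≡ k m))) (trans (fromℤ-⊖ (k ℕ.* m) 1) (+-congˡ (-‿cong (+-identityʳ 1#))))
    where
    θ₁≡ : ∀ k m → θ₁ (suc (suc k) ℕ.+ m) (suc k) ≡ ℤ.+ (k ℕ.* m) ℤ.- ℤ.1ℤ
    θ₁≡ k m = ≡.trans
      (≡.cong (λ i → (ℤ.+ suc k ℤ.- ℤ.1ℤ) ℤ.* (i ℤ.- ℤ.+ suc k ℤ.- ℤ.1ℤ) ℤ.- ℤ.1ℤ) (ℤₚ.pos-+ (suc (suc k)) m))
              (≡.trans (simplify (ℤ.+ suc k) (ℤ.+ m)) (≡.cong (ℤ._- ℤ.1ℤ) (≡.sym (ℤₚ.pos-* k m))))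
      where
      simplify : ∀ a b →
        (a ℤ.- ℤ.1ℤ) ℤ.* (((ℤ.1ℤ ℤ.+ a) ℤ.+ b) ℤ.- a ℤ.- ℤ.1ℤ) ℤ.- ℤ.1ℤ ≡ (a ℤ.- ℤ.1ℤ) ℤ.* b ℤ.- ℤ.1ℤ
      simplify = solve-∀

open import Data.Nat using (_≤_; _<_)

lemma1 : ∀ {c ℓ₁ ℓ₂} (F : FloorField c ℓ₁ ℓ₂) (n k : ℕ) → 1 ≤ k → k < n →
    let open FloorField F
        open Over F
    in
    (∀ (v : Subset n → Carrier) → IsEigenvector n k (fromℤ (θ₁ n k)) v →
      ∃ λ (u : Fin n → Carrier) → (sumAll n u ≈ 0#) ×
        (∀ K → ∣ K ∣ ≡ k → Wᵀ n u K ≈ v K))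
    ×
    (∀ (u : Fin n → Carrier) → sumAll n u ≈ 0# →
      IsEigenvector n k (fromℤ (θ₁ n k)) (Wᵀ n u) → IsIntegral n k (Wᵀ n u) →
      (∀ i j → frac (u i) ≈ frac (u j)) ×
      ∃₂ λ (r s : ℕ) → (r ℕ.< s) × (gcd r s ≡ 1) × (s ∣ gcd n k) ×
        (∀ i → (frac (u i) * fromℕ s) ≈ fromℕ r))
lemma1 F _ (suc k) (ℕ.s≤s ℕ.z≤n) k+1<n with ℕₚ.m≤n⇒∃[o]m+o≡n k+1<n
... | m , ≡.refl =
  (λ v (_ , eig) → eigenvector⇒Wᵀ F _ k m (≡.cong suc (≡.sym (ℕₚ.+-suc k m))) v
                     (λ K ∣K∣ → trans (eig K ∣K∣) (*-congʳ (fromℤ-θ₁ F k m)))) ,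
  (λ u sum≈0 _ Wᵀ-int → integral-Wᵀ⇒common-fraction F _ k u k+1<n sum≈0 Wᵀ-int)
  where open FloorField F
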